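{- Let $t\ge1$ and let $n_1,\dots,n_k$ be nonnegative integers. Then \[ \mathcal{L}^{(t)}\Big(\prod_{i=1}^k H^{(t)}_{n_i}(x)\Big) \] equals the number of inhomogeneous coverings of $[n_1]\sqcup\cdots\sqcup[n_k]$ by $t$-paths, i.e. the number of ways to partition the set $[n_1]\sqcup\cdots\sqcup[n_k]$ into vertex sets of vertex-disjoint $t$-paths (each a sequence of $t+1$ distinct elements, considered up to reversal) such that no $t$-path has all of its vertices in a single $[n_i]$.
   Context: A $t$-path on a set of vertices is a path with $t$ edges through $t+1$ distinct vertices, i.e. an ordering of $t+1$ distinct vertices up to reversal; a set of $t+1$ labeled vertices carries $(t+1)!/2$ such paths. The Hermite polynomial of order $t$ is the higher-order matching polynomial of the complete graph $K_n$: $H^{(t)}_n(x)=\sum_S(-1)^{|S|}x^{\,n-(t+1)|S|}$, summed over all sets $S$ of pairwise vertex-disjoint $t$-paths in $K_n$ ($H^{(t)}_0=1$). Let $\mu^{(t)}_n$ be the number of complete coverings of $K_n$ by vertex-disjoint $t$-paths (so $\mu^{(t)}_n=0$ unless $(t+1)\mid n$, and $\mu^{(t)}_{(t+1)m}=\binom{(t+1)m}{t+1,\dots,t+1}\big(\tfrac{(t+1)!}{2}\big)^m$), and let $\mathcal{L}^{(t)}$ be the linear functional with $\mathcal{L}^{(t)}(x^n)=\mu^{(t)}_n$. -}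

module Defs where

open import Data.Nat using (ℕ; zero; suc; _+_; _*_; _∸_; _<ᵇ_; _≡ᵇ_)
open import Data.Integer using (ℤ; +_; -_) renaming (_+_ to _+ℤ_; _*_ to _*ℤ_)
open import Data.Bool using (Bool; true; false; not; _∧_; if_then_else_)
open import Data.List using (List; []; _∷_; map; concatMap; foldr; filterᵇ; length; allFin; replicate; _++_)
open import Data.Bool.ListAction using (all; any)
open import Data.Nat.ListAction using (sum)
open import Data.Vec as Vec using (Vec)
open import Data.Fin using (Fin; toℕ)

allVecs : (N len : ℕ) → List (Vec (Fin N) len)
allVecs N zero = Vec.[] ∷ []
allVecs N (suc len) = concatMap (λ v → map (λ a → a Vec.∷ v) (allFin N)) (allVecs N len)

allBoolLists : ℕ → List (List Bool)
allBoolLists zero = [] ∷ []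
allBoolLists (suc M) = concatMap (λ bs → (true ∷ bs) ∷ (false ∷ bs) ∷ []) (allBoolLists M)

selected : {A : Set} → List A → List Bool → List A
selected [] _ = []
selected (_ ∷ _) [] = []
selected (a ∷ as) (true ∷ bs) = a ∷ selected as bs
selected (a ∷ as) (false ∷ bs) = selected as bs

distinctᵇ : List ℕ → Bool
distinctᵇ [] = true
distinctᵇ (x ∷ xs) = not (any (x ≡ᵇ_) xs) ∧ distinctᵇ xs

-- t-paths in K_N (vertex set Fin N)
-- A t-path is a sequence of t+1 distinct vertices up to reversal; we use
-- the canonical representative of each reversal class: the one whose first
-- vertex is smaller than its last vertex (t ≥ 1, so the endpoints differ).

Path : ℕ → ℕ → Set
Path N t = Vec (Fin N) (suc t)

verts : {N t : ℕ} → Path N t → List ℕ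
verts v = map toℕ (Vec.toList v)

isPathRepᵇ : {N t : ℕ} → Path N t → Bool
isPathRepᵇ v = distinctᵇ (verts v) ∧ (toℕ (Vec.head v) <ᵇ toℕ (Vec.last v))

tPaths : (N t : ℕ) → List (Path N t)
tPaths N t = filterᵇ isPathRepᵇ (allVecs N (suc t))

pathSets : (N t : ℕ) → List (List (Path N t))
pathSets N t = map (selected (tPaths N t)) (allBoolLists (length (tPaths N t)))

disjointᵇ : {N t : ℕ} → List (Path N t) → Bool
disjointᵇ S = distinctᵇ (concatMap verts S)

coversᵇ : {N t : ℕ} → List (Path N t) → Bool
coversᵇ {N} S = all (λ v → any (toℕ v ≡ᵇ_) (concatMap verts S)) (allFin N)

-- Polynomials over ℤ as coefficient lists (index i = coefficient of x^i)

Poly : Set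
Poly = List ℤ

_⊕_ : Poly → Poly → Poly
[] ⊕ q = q
(a ∷ p) ⊕ [] = a ∷ p
(a ∷ p) ⊕ (b ∷ q) = (a +ℤ b) ∷ (p ⊕ q)

_⊗_ : Poly → Poly → Poly
[] ⊗ q = []
(a ∷ p) ⊗ q = map (a *ℤ_) q ⊕ (+ 0 ∷ (p ⊗ q))

monomial : ℤ → ℕ → Poly
monomial c d = replicate d (+ 0) ++ (c ∷ [])

sign : ℕ → ℤ
sign zero = + 1
sign (suc j) = - sign j

hermite : (t N : ℕ) → Poly
hermite t N = foldr _⊕_ []
  (map (λ S → monomial (sign (length S)) (N ∸ (suc t * length S)))
       (filterᵇ disjointᵇ (pathSets N t)))

μ : (t N : ℕ) → ℕ
μ t N = length (filterᵇ (λ S → disjointᵇ S ∧ coversᵇ S) (pathSets N t))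

𝓛-from : ℕ → ℕ → Poly → ℤ
𝓛-from t i [] = + 0
𝓛-from t i (a ∷ p) = (a *ℤ + μ t i) +ℤ 𝓛-from t (suc i) p

𝓛 : ℕ → Poly → ℤ
𝓛 t = 𝓛-from t 0

polyProd : List Poly → Poly
polyProd = foldr _⊗_ (+ 1 ∷ [])

-- Disjoint union [n_1] ⊔ ... ⊔ [n_k], realised as Fin (n_1+...+n_k)
-- with the i-th block consisting of the consecutive vertices
-- n_1+...+n_{i-1}, ..., n_1+...+n_i - 1.

blockOf : List ℕ → ℕ → ℕ
blockOf [] v = 0
blockOf (n ∷ ns) v = if v <ᵇ n then 0 else suc (blockOf ns (v ∸ n))

homogeneousᵇ : {N t : ℕ} → List ℕ → Path N t → Bool
homogeneousᵇ ns p = all (λ w → blockOf ns w ≡ᵇ blockOf ns (toℕ (Vec.head p))) (verts p)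

inhomCoverings : (t : ℕ) → List ℕ → ℕ
inhomCoverings t ns = length (filterᵇ
  (λ S → disjointᵇ S ∧ coversᵇ S ∧ all (λ p → not (homogeneousᵇ ns p)) S)
  (pathSets (sum ns) t))

-- Expanding the product, ∏ᵢ H⁽ᵗ⁾_{nᵢ}(x) = Σ_T (-1)^{|T|} x^{N-(t+1)|T|}, where N = n₁ + ⋯ + nₖ and T
-- runs over the sets of vertex-disjoint t-paths of K_N each lying inside one block [nᵢ]: a set of such
-- homogeneous paths splits uniquely into sets of paths inside the single blocks. Applying 𝓛 replaces
-- x^{N-(t+1)|T|} by μ_{N-(t+1)|T|}, the number of coverings S of K_N by t-paths that contain T. Hence
-- 𝓛(∏ᵢ H_{nᵢ}) = Σ_S Σ_{T ⊆ S homogeneous} (-1)^{|T|}, and by inclusion–exclusion the inner sum is 1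
-- when S has no homogeneous path and 0 otherwise.

module Submission where

open import Defs
open import Data.Bool.Base using (Bool; true; false; not; _∧_; _∨_; if_then_else_)
open import Data.Bool.ListAction using (all; any)
open import Data.Bool.Properties
  using (∧-commutativeMonoid; ∧-comm; ∧-assoc; ∨-assoc; ∧-zeroʳ; ∧-identityʳ; ∨-zeroʳ)
open import Algebra.Solver.CommutativeMonoid ∧-commutativeMonoid using (solve; _⊜_) renaming (_⊕_ to _∧′_)
open import Data.Nat.ListAction using (sum)
open import Data.Nat.Base as ℕ using (ℕ; zero; suc; _∸_; _≡ᵇ_; _<ᵇ_; _≤_; _<_; z≤n; s≤s)
import Data.Nat.Properties as ℕ
open import Data.Integer.Base using (ℤ; +_; -_; _+_; _*_; _-_)
import Data.Integer.Properties as ℤ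
open import Data.Integer.Tactic.RingSolver using (solve-∀)
open import Data.List.Base using (List; []; _∷_; _++_; map; concatMap; foldr; filterᵇ; length; allFin)
import Data.List.Properties as List
open import Data.Fin.Base as Fin using (Fin; toℕ)
import Data.Fin.Properties as Fin
open import Data.Vec.Base as Vec using (Vec)
import Data.Vec.Properties as Vec
open import Function.Base using (_∘_)
open import Relation.Binary.Core using (_Preserves_⟶_)
open import Relation.Binary.Definitions using (tri<; tri≈; tri>)
open import Relation.Binary.PropositionalEquality

private
  variable
    A B : Set

≡ᵇ-refl : ∀ m → (m ≡ᵇ m) ≡ true
≡ᵇ-refl zero    = refl
≡ᵇ-refl (suc m) = ≡ᵇ-refl m

≡ᵇ-sym : ∀ m n → (m ≡ᵇ n) ≡ (n ≡ᵇ m)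
≡ᵇ-sym zero    zero    = refl
≡ᵇ-sym zero    (suc n) = refl
≡ᵇ-sym (suc m) zero    = refl
≡ᵇ-sym (suc m) (suc n) = ≡ᵇ-sym m n

≡ᵇ⇒≡ : ∀ m n → (m ≡ᵇ n) ≡ true → m ≡ n
≡ᵇ⇒≡ zero    zero    _  = refl
≡ᵇ⇒≡ (suc m) (suc n) eq = cong suc (≡ᵇ⇒≡ m n eq)

<⇒<ᵇ : ∀ {m n} → m < n → (m <ᵇ n) ≡ true
<⇒<ᵇ {zero}  {suc n} _         = refl
<⇒<ᵇ {suc m} {suc n} (s≤s m<n) = <⇒<ᵇ m<n

<ᵇ⇒< : ∀ {m n} → (m <ᵇ n) ≡ true → m < n
<ᵇ⇒< {zero}  {suc n} _    = s≤s z≤n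
<ᵇ⇒< {suc m} {suc n} m<n = s≤s (<ᵇ⇒< m<n)

<⇒≢ᵇ : ∀ {m n} → m < n → (m ≡ᵇ n) ≡ false
<⇒≢ᵇ {zero}  {suc n} _         = refl
<⇒≢ᵇ {suc m} {suc n} (s≤s m<n) = <⇒≢ᵇ m<n

≤⇒≮ᵇ : ∀ {m n} → n ≤ m → (m <ᵇ n) ≡ false
≤⇒≮ᵇ {m}     {zero}  _         = refl
≤⇒≮ᵇ {suc m} {suc n} (s≤s n≤m) = ≤⇒≮ᵇ n≤m

∧≡true⇒ˡ : ∀ {a b} → a ∧ b ≡ true → a ≡ true
∧≡true⇒ˡ {true} _ = refl

∧≡true⇒ʳ : ∀ {a b} → a ∧ b ≡ true → b ≡ true
∧≡true⇒ʳ {true} b≡true = b≡true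

not≡true⇒ : ∀ {a} → not a ≡ true → a ≡ false
not≡true⇒ {false} _ = refl

not-∨ : ∀ a b → not (a ∨ b) ≡ not a ∧ not b
not-∨ true  b = refl
not-∨ false b = refl

∧-leftComm : ∀ a b c → a ∧ (b ∧ c) ≡ b ∧ (a ∧ c)
∧-leftComm = solve 3 (λ a b c → a ∧′ (b ∧′ c) ⊜ b ∧′ (a ∧′ c)) refl

∨-leftComm : ∀ a b c → a ∨ (b ∨ c) ≡ b ∨ (a ∨ c)
∨-leftComm true  b c = sym (∨-zeroʳ b)
∨-leftComm false b c = refl

all-++ : ∀ (p : A → Bool) xs ys → all p (xs ++ ys) ≡ all p xs ∧ all p ys
all-++ p []       ys = refl
all-++ p (x ∷ xs) ys = trans (cong (p x ∧_) (all-++ p xs ys)) (sym (∧-assoc (p x) _ _))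

any-++ : ∀ (p : A → Bool) xs ys → any p (xs ++ ys) ≡ any p xs ∨ any p ys
any-++ p []       ys = refl
any-++ p (x ∷ xs) ys = trans (cong (p x ∨_) (any-++ p xs ys)) (sym (∨-assoc (p x) _ _))

all-cong : ∀ {p q : A → Bool} xs → (∀ x → p x ≡ q x) → all p xs ≡ all q xs
all-cong []       p≗q = refl
all-cong (x ∷ xs) p≗q = cong₂ _∧_ (p≗q x) (all-cong xs p≗q)

any-cong : ∀ {p q : A → Bool} xs → (∀ x → p x ≡ q x) → any p xs ≡ any q xs
any-cong []       p≗q = refl
any-cong (x ∷ xs) p≗q = cong₂ _∨_ (p≗q x) (any-cong xs p≗q)

all-map : ∀ (p : B → Bool) (f : A → B) xs → all p (map f xs) ≡ all (p ∘ f) xs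
all-map p f []       = refl
all-map p f (x ∷ xs) = cong (p (f x) ∧_) (all-map p f xs)

any-map : ∀ (p : B → Bool) (f : A → B) xs → any p (map f xs) ≡ any (p ∘ f) xs
any-map p f []       = refl
any-map p f (x ∷ xs) = cong (p (f x) ∨_) (any-map p f xs)

all-concatMap : ∀ (p : B → Bool) (f : A → List B) xs → all p (concatMap f xs) ≡ all (all p ∘ f) xs
all-concatMap p f []       = refl
all-concatMap p f (x ∷ xs) = trans (all-++ p (f x) _) (cong (all p (f x) ∧_) (all-concatMap p f xs))

all-∧ : ∀ (p q : A → Bool) xs → all (λ x → p x ∧ q x) xs ≡ all p xs ∧ all q xs
all-∧ p q []       = refl
all-∧ p q (x ∷ xs) = trans (cong ((p x ∧ q x) ∧_) (all-∧ p q xs)) (interchange (p x) (q x) _ _)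
  where
  interchange : ∀ a b c d → (a ∧ b) ∧ (c ∧ d) ≡ (a ∧ c) ∧ (b ∧ d)
  interchange = solve 4 (λ a b c d → (a ∧′ b) ∧′ (c ∧′ d) ⊜ (a ∧′ c) ∧′ (b ∧′ d)) refl

all-true : ∀ {p : A → Bool} xs → (∀ x → p x ≡ true) → all p xs ≡ true
all-true []       p≡true = refl
all-true (x ∷ xs) p≡true rewrite p≡true x = all-true xs p≡true

all-mono : ∀ {p q : A → Bool} xs → (∀ x → p x ≡ true → q x ≡ true) → all p xs ≡ true → all q xs ≡ true
all-mono []       p⇒q _ = refl
all-mono {p = p} (x ∷ xs) p⇒q all-p with p x in px
... | true = cong₂ _∧_ (p⇒q x px) (all-mono xs p⇒q all-p)

all-insert : ∀ (p : A → Bool) x xs ys → all p (x ∷ xs ++ ys) ≡ all p (xs ++ x ∷ ys)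
all-insert p x xs ys = trans (cong (p x ∧_) (all-++ p xs ys))
  (trans (∧-leftComm (p x) (all p xs) (all p ys)) (sym (all-++ p xs (x ∷ ys))))

any-swap : ∀ (p : A → Bool) xs ys zs → any p (xs ++ ys ++ zs) ≡ any p (ys ++ xs ++ zs)
any-swap p xs ys zs =
  trans (trans (any-++ p xs (ys ++ zs)) (cong (any p xs ∨_) (any-++ p ys zs)))
        (trans (∨-leftComm (any p xs) (any p ys) (any p zs))
               (sym (trans (any-++ p ys (xs ++ zs)) (cong (any p ys ∨_) (any-++ p xs zs)))))

filterᵇ-∷ : ∀ (p : A → Bool) x xs →
  filterᵇ p (x ∷ xs) ≡ (if p x then x ∷ filterᵇ p xs else filterᵇ p xs)
filterᵇ-∷ p x xs with p x
... | true  = refl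
... | false = refl

filterᵇ-cong : ∀ {φ ψ : A → Bool} xs → (∀ x → φ x ≡ ψ x) → filterᵇ φ xs ≡ filterᵇ ψ xs
filterᵇ-cong []                     φ≗ψ = refl
filterᵇ-cong {φ = φ} {ψ} (x ∷ xs) φ≗ψ rewrite filterᵇ-∷ φ x xs | filterᵇ-∷ ψ x xs | φ≗ψ x with ψ x
... | true  = cong (x ∷_) (filterᵇ-cong xs φ≗ψ)
... | false = filterᵇ-cong xs φ≗ψ

filterᵇ-false : ∀ (xs : List A) → filterᵇ (λ _ → false) xs ≡ []
filterᵇ-false []       = refl
filterᵇ-false (x ∷ xs) = filterᵇ-false xs

filterᵇ-true : ∀ (xs : List A) → filterᵇ (λ _ → true) xs ≡ xs
filterᵇ-true []       = refl
filterᵇ-true (x ∷ xs) = cong (x ∷_) (filterᵇ-true xs)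

filterᵇ-map : ∀ (φ : B → Bool) (g : A → B) xs → filterᵇ φ (map g xs) ≡ map g (filterᵇ (φ ∘ g) xs)
filterᵇ-map φ g []       = refl
filterᵇ-map φ g (x ∷ xs) rewrite filterᵇ-∷ φ (g x) (map g xs) | filterᵇ-∷ (φ ∘ g) x xs with φ (g x)
... | true  = cong (g x ∷_) (filterᵇ-map φ g xs)
... | false = filterᵇ-map φ g xs

filterᵇ-filterᵇ : ∀ (φ ψ : A → Bool) xs → filterᵇ φ (filterᵇ ψ xs) ≡ filterᵇ (λ x → ψ x ∧ φ x) xs
filterᵇ-filterᵇ φ ψ []       = refl
filterᵇ-filterᵇ φ ψ (x ∷ xs) rewrite filterᵇ-∷ ψ x xs | filterᵇ-∷ (λ x → ψ x ∧ φ x) x xs with ψ x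
... | true  rewrite filterᵇ-∷ φ x (filterᵇ ψ xs) with φ x
...   | true  = cong (x ∷_) (filterᵇ-filterᵇ φ ψ xs)
...   | false = filterᵇ-filterᵇ φ ψ xs
filterᵇ-filterᵇ φ ψ (x ∷ xs) | false = filterᵇ-filterᵇ φ ψ xs

filterᵇ-comm : ∀ (φ ψ : A → Bool) xs → filterᵇ φ (filterᵇ ψ xs) ≡ filterᵇ ψ (filterᵇ φ xs)
filterᵇ-comm φ ψ xs = trans (filterᵇ-filterᵇ φ ψ xs)
  (trans (filterᵇ-cong xs (λ x → ∧-comm (ψ x) (φ x))) (sym (filterᵇ-filterᵇ ψ φ xs)))

filterᵇ-concatMap : ∀ (φ : B → Bool) (f : A → List B) xs →
  filterᵇ φ (concatMap f xs) ≡ concatMap (filterᵇ φ ∘ f) xs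
filterᵇ-concatMap φ f []       = refl
filterᵇ-concatMap φ f (x ∷ xs) =
  trans (List.filter-++ _ (f x) (concatMap f xs)) (cong (filterᵇ φ (f x) ++_) (filterᵇ-concatMap φ f xs))

concatMap-filterᵇ : ∀ (f : A → List B) (q : A → Bool) xs →
  concatMap f (filterᵇ q xs) ≡ concatMap (λ x → if q x then f x else []) xs
concatMap-filterᵇ f q []       = refl
concatMap-filterᵇ f q (x ∷ xs) rewrite filterᵇ-∷ q x xs with q x
... | true  = cong (f x ++_) (concatMap-filterᵇ f q xs)
... | false = concatMap-filterᵇ f q xs

all-filterᵇ : ∀ (p φ : A → Bool) xs → (∀ x → p x ≡ false → φ x ≡ true) → all φ xs ≡ all φ (filterᵇ p xs)
all-filterᵇ p φ []       φ-outside = refl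
all-filterᵇ p φ (x ∷ xs) φ-outside rewrite filterᵇ-∷ p x xs with p x in px
... | true  = cong (φ x ∧_) (all-filterᵇ p φ xs φ-outside)
... | false rewrite φ-outside x px = all-filterᵇ p φ xs φ-outside

allFin-suc : ∀ n → allFin (suc n) ≡ Fin.zero ∷ map Fin.suc (allFin n)
allFin-suc n = cong (Fin.zero ∷_) (sym (List.map-tabulate (λ i → i) Fin.suc))

last-map : ∀ {k} (f : A → B) (v : Vec A (suc k)) → Vec.last (Vec.map f v) ≡ f (Vec.last v)
last-map f (x Vec.∷ Vec.[])      = refl
last-map f (x Vec.∷ y Vec.∷ v)   = last-map f (y Vec.∷ v)

⟦_⟧ : Bool → ℤ
⟦ true ⟧  = + 1
⟦ false ⟧ = + 0

⟦∧⟧ : ∀ a b → ⟦ a ∧ b ⟧ ≡ ⟦ a ⟧ * ⟦ b ⟧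
⟦∧⟧ true  b = sym (ℤ.*-identityˡ ⟦ b ⟧)
⟦∧⟧ false b = refl

⟦not⟧ : ∀ a → ⟦ not a ⟧ ≡ + 1 - ⟦ a ⟧
⟦not⟧ true  = refl
⟦not⟧ false = refl

∑ : (A → ℤ) → List A → ℤ
∑ f []       = + 0
∑ f (x ∷ xs) = f x + ∑ f xs

∑-map : ∀ (f : B → ℤ) (g : A → B) (xs : List A) → ∑ f (map g xs) ≡ ∑ (f ∘ g) xs
∑-map f g []       = refl
∑-map f g (x ∷ xs) = cong (_+_ (f (g x))) (∑-map f g xs)

∑-filterᵇ : ∀ (f : A → ℤ) φ (xs : List A) → ∑ f (filterᵇ φ xs) ≡ ∑ (λ x → ⟦ φ x ⟧ * f x) xs
∑-filterᵇ f φ [] = refl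
∑-filterᵇ f φ (x ∷ xs) rewrite filterᵇ-∷ φ x xs with φ x
... | true  = cong₂ _+_ (sym (ℤ.*-identityˡ (f x))) (∑-filterᵇ f φ xs)
... | false = trans (∑-filterᵇ f φ xs) (sym (ℤ.+-identityˡ _))

length-filterᵇ : ∀ (φ : A → Bool) (xs : List A) → + length (filterᵇ φ xs) ≡ ∑ (⟦_⟧ ∘ φ) xs
length-filterᵇ φ [] = refl
length-filterᵇ φ (x ∷ xs) rewrite filterᵇ-∷ φ x xs with φ x
... | true  = cong (_+_ (+ 1)) (length-filterᵇ φ xs)
... | false = trans (length-filterᵇ φ xs) (sym (ℤ.+-identityˡ _))

-- sumSubsets P f = Σ_{S ⊆ P} f S, each sublist S keeping the order of P
sumSubsets : List A → (List A → ℤ) → ℤ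
sumSubsets []       f = f []
sumSubsets (x ∷ xs) f = sumSubsets xs (λ S → f (x ∷ S) + f S)

sumSubsets-cong : ∀ (P : List A) {f g : List A → ℤ} → (∀ S → f S ≡ g S) → sumSubsets P f ≡ sumSubsets P g
sumSubsets-cong []      f≗g = f≗g []
sumSubsets-cong (x ∷ P) f≗g = sumSubsets-cong P (λ S → cong₂ _+_ (f≗g (x ∷ S)) (f≗g S))

sumSubsets-+ : ∀ (P : List A) f g → sumSubsets P (λ S → f S + g S) ≡ sumSubsets P f + sumSubsets P g
sumSubsets-+ []      f g = refl
sumSubsets-+ (x ∷ P) f g =
  trans (sumSubsets-cong P (λ S → interchange (f (x ∷ S)) (g (x ∷ S)) (f S) (g S)))
        (sumSubsets-+ P _ _)
  where
  interchange : ∀ a b c d → (a + b) + (c + d) ≡ (a + c) + (b + d)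
  interchange = solve-∀

sumSubsets-* : ∀ (P : List A) c f → sumSubsets P (λ S → c * f S) ≡ c * sumSubsets P f
sumSubsets-* []      c f = refl
sumSubsets-* (x ∷ P) c f =
  trans (sumSubsets-cong P (λ S → sym (ℤ.*-distribˡ-+ c (f (x ∷ S)) (f S)))) (sumSubsets-* P c _)

sumSubsets-0 : ∀ (P : List A) → sumSubsets P (λ _ → + 0) ≡ + 0
sumSubsets-0 []      = refl
sumSubsets-0 (x ∷ P) = sumSubsets-0 P

sumSubsets-map : ∀ (g : A → B) (P : List A) (h : List B → ℤ) →
  sumSubsets (map g P) h ≡ sumSubsets P (h ∘ map g)
sumSubsets-map g []      h = refl
sumSubsets-map g (x ∷ P) h = sumSubsets-map g P (λ S → h (g x ∷ S) + h S)

∑-selected : ∀ (P : List A) (F : List A → ℤ) → ∑ (F ∘ selected P) (allBoolLists (length P)) ≡ sumSubsets P F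
∑-selected []      F = ℤ.+-identityʳ (F [])
∑-selected (x ∷ P) F = trans (∑-pairs (allBoolLists (length P))) (∑-selected P _)
  where
  ∑-pairs : ∀ bss → ∑ (F ∘ selected (x ∷ P)) (concatMap (λ bs → (true ∷ bs) ∷ (false ∷ bs) ∷ []) bss)
                  ≡ ∑ (λ bs → F (x ∷ selected P bs) + F (selected P bs)) bss
  ∑-pairs []         = refl
  ∑-pairs (bs ∷ bss) = trans (sym (ℤ.+-assoc (F (x ∷ selected P bs)) (F (selected P bs)) _))
                                (cong (_+_ (F (x ∷ selected P bs) + F (selected P bs))) (∑-pairs bss))

sumSubsets-restrict : ∀ (q : A → Bool) (P : List A) (h : List A → ℤ) →
  (∀ S → all q S ≡ false → h S ≡ + 0) → sumSubsets P h ≡ sumSubsets (filterᵇ q P) h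
sumSubsets-restrict q []      h h≡0 = refl
sumSubsets-restrict q (x ∷ P) h h≡0 rewrite filterᵇ-∷ q x P with q x in qx
... | true  = sumSubsets-restrict q P (λ S → h (x ∷ S) + h S)
                (λ S ¬qS → cong₂ _+_ (h≡0 (x ∷ S) (trans (cong (_∧ all q S) qx) ¬qS)) (h≡0 S ¬qS))
... | false = trans (sumSubsets-cong P (λ S → trans (cong (_+ h S) (h≡0 (x ∷ S) (cong (_∧ all q S) qx)))
                                             (ℤ.+-identityˡ (h S))))
                    (sumSubsets-restrict q P h h≡0)

-- Sums over sublists of a partitioned list produce the sublists interleaved differently,
-- so regrouping them needs the summand to ignore the position of an element.
InsertionInvariant : (List A → ℤ) → Set
InsertionInvariant f = ∀ x as bs → f (x ∷ as ++ bs) ≡ f (as ++ x ∷ bs)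

insertionInvariant-∷ : ∀ {f : List A → ℤ} x → InsertionInvariant f → InsertionInvariant (λ S → f (x ∷ S))
insertionInvariant-∷ x inv y as bs = trans (inv x (y ∷ []) (as ++ bs)) (inv y (x ∷ as) bs)

insertionInvariant-+ : ∀ {f g : List A → ℤ} →
  InsertionInvariant f → InsertionInvariant g → InsertionInvariant (λ S → f S + g S)
insertionInvariant-+ invf invg x as bs = cong₂ _+_ (invf x as bs) (invg x as bs)

insertionInvariant-step : ∀ {f : List A → ℤ} x →
  InsertionInvariant f → InsertionInvariant (λ S → f (x ∷ S) + f S)
insertionInvariant-step {f = f} x inv =
  insertionInvariant-+ {f = λ S → f (x ∷ S)} {g = f} (insertionInvariant-∷ {f = f} x inv) inv

sumSubsets-partition : ∀ (q : A → Bool) (P : List A) (f : List A → ℤ) → InsertionInvariant f →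
  sumSubsets P f ≡
  sumSubsets (filterᵇ q P) (λ as → sumSubsets (filterᵇ (not ∘ q) P) (λ bs → f (as ++ bs)))
sumSubsets-partition q []      f inv = refl
sumSubsets-partition q (x ∷ P) f inv
  rewrite filterᵇ-∷ q x P | filterᵇ-∷ (not ∘ q) x P with q x
... | true  = trans (sumSubsets-partition q P _ (insertionInvariant-step {f = f} x inv))
                    (sumSubsets-cong (filterᵇ q P) (λ as →
                      sumSubsets-+ (filterᵇ (not ∘ q) P) (λ bs → f (x ∷ as ++ bs)) (λ bs → f (as ++ bs))))
... | false = trans (sumSubsets-partition q P _ (insertionInvariant-step {f = f} x inv))
                    (sumSubsets-cong (filterᵇ q P) (λ as → sumSubsets-cong (filterᵇ (not ∘ q) P) (λ bs →
                      cong (_+ f (as ++ bs)) (inv x as bs))))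

-- sumNested P g = Σ_{T ⊆ S ⊆ P} g T S
sumNested : List A → (List A → List A → ℤ) → ℤ
sumNested []      g = g [] []
sumNested (x ∷ P) g = sumNested P (λ T S → g (x ∷ T) (x ∷ S) + (g T (x ∷ S) + g T S))

sumNested-cong : ∀ (P : List A) {f g : List A → List A → ℤ} →
  (∀ T S → f T S ≡ g T S) → sumNested P f ≡ sumNested P g
sumNested-cong []      f≗g = f≗g [] []
sumNested-cong (x ∷ P) f≗g =
  sumNested-cong P (λ T S → cong₂ _+_ (f≗g (x ∷ T) (x ∷ S)) (cong₂ _+_ (f≗g T (x ∷ S)) (f≗g T S)))

-- sumSplits P h = Σ_{P = T ⊔ R} h T R
sumSplits : List A → (List A → List A → ℤ) → ℤ
sumSplits []      h = h [] []
sumSplits (x ∷ P) h = sumSplits P (λ T R → h (x ∷ T) R + h T (x ∷ R))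

data Split {A : Set} : List A → List A → List A → Set where
  []  : Split [] [] []
  _∷ˡ_ : ∀ {P T R} x → Split P T R → Split (x ∷ P) (x ∷ T) R
  _∷ʳ_ : ∀ {P T R} x → Split P T R → Split (x ∷ P) T (x ∷ R)

filterᵇ-Split : ∀ (q : A → Bool) {P T R} → Split P T R → all (not ∘ q) T ≡ true → filterᵇ q R ≡ filterᵇ q P
filterᵇ-Split q []       _ = refl
filterᵇ-Split q {x ∷ P} (x ∷ˡ sp) ¬qT rewrite filterᵇ-∷ q x P with q x | ¬qT
... | false | ¬qT′ = filterᵇ-Split q sp ¬qT′
filterᵇ-Split q {x ∷ P} {R = x ∷ R} (x ∷ʳ sp) ¬qT rewrite filterᵇ-∷ q x P | filterᵇ-∷ q x R with q x
... | true  = cong (x ∷_) (filterᵇ-Split q sp ¬qT)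
... | false = filterᵇ-Split q sp ¬qT

sumSplits-cong : ∀ (P : List A) {f g : List A → List A → ℤ} →
  (∀ T R → Split P T R → f T R ≡ g T R) → sumSplits P f ≡ sumSplits P g
sumSplits-cong []      f≗g = f≗g [] [] []
sumSplits-cong (x ∷ P) f≗g =
  sumSplits-cong P (λ T R sp → cong₂ _+_ (f≗g _ _ (x ∷ˡ sp)) (f≗g _ _ (x ∷ʳ sp)))

sumSplits-fst : ∀ (P : List A) (h : List A → ℤ) → sumSplits P (λ T _ → h T) ≡ sumSubsets P h
sumSplits-fst []      h = refl
sumSplits-fst (x ∷ P) h = sumSplits-fst P (λ T → h (x ∷ T) + h T)

sumNested-by-splits : ∀ (P : List A) (G : List A → List A → ℤ) → (∀ T → InsertionInvariant (G T)) →
  sumNested P G ≡ sumSplits P (λ T R → sumSubsets R (λ X → G T (T ++ X)))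
sumNested-by-splits []      G inv = refl
sumNested-by-splits (x ∷ P) G inv = trans (sumNested-by-splits P _ inv′) (sumSplits-cong P (λ T R _ →
  trans (sumSubsets-+ R (λ X → G (x ∷ T) (x ∷ T ++ X)) (λ X → G T (x ∷ T ++ X) + G T (T ++ X)))
        (cong (_+_ (sumSubsets R (λ X → G (x ∷ T) (x ∷ T ++ X))))
              (sumSubsets-cong R (λ X → cong (_+ G T (T ++ X)) (inv T x T X))))))
  where
  inv′ : ∀ T → InsertionInvariant (λ S → G (x ∷ T) (x ∷ S) + (G T (x ∷ S) + G T S))
  inv′ T = insertionInvariant-+ {f = λ S → G (x ∷ T) (x ∷ S)} {g = λ S → G T (x ∷ S) + G T S}
             (insertionInvariant-∷ {f = G (x ∷ T)} x (inv (x ∷ T)))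
             (insertionInvariant-step {f = G T} x (inv T))

inclusion-exclusion : ∀ (P : List A) (h : A → Bool) (f : List A → ℤ) →
  sumNested P (λ T S → ⟦ all h T ⟧ * sign (length T) * f S) ≡
  sumSubsets P (λ S → ⟦ all (not ∘ h) S ⟧ * f S)
inclusion-exclusion []      h f = refl
inclusion-exclusion (x ∷ P) h f =
  trans (sumNested-cong P collect)
        (trans (inclusion-exclusion P h f′) (sumSubsets-cong P distribute))
  where
  f′ : List _ → ℤ
  f′ S = ⟦ not (h x) ⟧ * f (x ∷ S) + f S
  collect : ∀ T S →
    ⟦ h x ∧ all h T ⟧ * - sign (length T) * f (x ∷ S) +
    (⟦ all h T ⟧ * sign (length T) * f (x ∷ S) + ⟦ all h T ⟧ * sign (length T) * f S)
    ≡ ⟦ all h T ⟧ * sign (length T) * f′ S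
  collect T S rewrite ⟦∧⟧ (h x) (all h T) | ⟦not⟧ (h x) =
    ring ⟦ h x ⟧ ⟦ all h T ⟧ (sign (length T)) (f (x ∷ S)) (f S)
    where
    ring : ∀ a b s u v → a * b * - s * u + (b * s * u + b * s * v) ≡ b * s * ((+ 1 - a) * u + v)
    ring = solve-∀
  distribute : ∀ S → ⟦ all (not ∘ h) S ⟧ * f′ S ≡
    ⟦ not (h x) ∧ all (not ∘ h) S ⟧ * f (x ∷ S) + ⟦ all (not ∘ h) S ⟧ * f S
  distribute S rewrite ⟦∧⟧ (not (h x)) (all (not ∘ h) S) =
    ring ⟦ not (h x) ⟧ ⟦ all (not ∘ h) S ⟧ (f (x ∷ S)) (f S)
    where
    ring : ∀ a b u v → b * (a * u + v) ≡ a * b * u + b * v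
    ring = solve-∀

eval : (ℕ → ℤ) → Poly → ℤ
eval w []      = + 0
eval w (a ∷ p) = a * w 0 + eval (w ∘ suc) p

eval-cong : ∀ {w w′ : ℕ → ℤ} p → (∀ i → w i ≡ w′ i) → eval w p ≡ eval w′ p
eval-cong []      w≗w′ = refl
eval-cong (a ∷ p) w≗w′ = cong₂ _+_ (cong (a *_) (w≗w′ 0)) (eval-cong p (w≗w′ ∘ suc))

eval-⊕ : ∀ w p q → eval w (p ⊕ q) ≡ eval w p + eval w q
eval-⊕ w []      q       = sym (ℤ.+-identityˡ _)
eval-⊕ w (a ∷ p) []      = sym (ℤ.+-identityʳ _)
eval-⊕ w (a ∷ p) (b ∷ q) =
  trans (cong (_+_ ((a + b) * w 0)) (eval-⊕ (w ∘ suc) p q)) (ring a b (w 0) _ _)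
  where
  ring : ∀ a b x u v → (a + b) * x + (u + v) ≡ (a * x + u) + (b * x + v)
  ring = solve-∀

eval-scale : ∀ w a q → eval w (map (a *_) q) ≡ a * eval w q
eval-scale w a []      = sym (ℤ.*-zeroʳ a)
eval-scale w a (b ∷ q) =
  trans (cong (_+_ (a * b * w 0)) (eval-scale (w ∘ suc) a q)) (ring a b (w 0) _)
  where
  ring : ∀ a b x u → a * b * x + a * u ≡ a * (b * x + u)
  ring = solve-∀

eval-⊗ : ∀ w p q → eval w (p ⊗ q) ≡ eval (λ i → eval (λ j → w (i ℕ.+ j)) q) p
eval-⊗ w []      q = refl
eval-⊗ w (a ∷ p) q =
  trans (eval-⊕ w (map (a *_) q) (+ 0 ∷ (p ⊗ q)))
        (cong₂ _+_ (eval-scale w a q)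
                   (trans (ℤ.+-identityˡ _) (eval-⊗ (w ∘ suc) p q)))

eval-monomial : ∀ w c d → eval w (monomial c d) ≡ c * w d
eval-monomial w c zero    = ℤ.+-identityʳ _
eval-monomial w c (suc d) = trans (ℤ.+-identityˡ _) (eval-monomial (w ∘ suc) c d)

eval-foldr-⊕ : ∀ w ps → eval w (foldr _⊕_ [] ps) ≡ ∑ (eval w) ps
eval-foldr-⊕ w []       = refl
eval-foldr-⊕ w (p ∷ ps) = trans (eval-⊕ w p _) (cong (_+_ (eval w p)) (eval-foldr-⊕ w ps))

𝓛-from≡eval : ∀ t i p → 𝓛-from t i p ≡ eval (λ j → + μ t (i ℕ.+ j)) p
𝓛-from≡eval t i []      = refl
𝓛-from≡eval t i (a ∷ p) =
  cong₂ _+_ (cong (λ k → a * + μ t k) (sym (ℕ.+-identityʳ i)))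
            (trans (𝓛-from≡eval t (suc i) p) (eval-cong p (λ j → cong (+_ ∘ μ t) (sym (ℕ.+-suc i j)))))

all-not-≡ᵇ : ∀ y xs → all (λ x → not (x ≡ᵇ y)) xs ≡ not (any (y ≡ᵇ_) xs)
all-not-≡ᵇ y []       = refl
all-not-≡ᵇ y (x ∷ xs) =
  trans (cong₂ _∧_ (cong not (≡ᵇ-sym x y)) (all-not-≡ᵇ y xs)) (sym (not-∨ (y ≡ᵇ x) _))

apartᵇ : List ℕ → List ℕ → Bool
apartᵇ xs ys = all (λ y → not (any (y ≡ᵇ_) xs)) ys

apartᵇ-∷ˡ : ∀ x xs ys → apartᵇ (x ∷ xs) ys ≡ not (any (x ≡ᵇ_) ys) ∧ apartᵇ xs ys
apartᵇ-∷ˡ x xs ys = trans (all-cong ys (λ y → not-∨ (y ≡ᵇ x) (any (y ≡ᵇ_) xs)))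
  (trans (all-∧ (λ y → not (y ≡ᵇ x)) (λ y → not (any (y ≡ᵇ_) xs)) ys)
         (cong (_∧ apartᵇ xs ys) (all-not-≡ᵇ x ys)))

apartᵇ-sym : ∀ xs ys → apartᵇ xs ys ≡ apartᵇ ys xs
apartᵇ-sym xs []       = sym (all-true xs (λ _ → refl))
apartᵇ-sym xs (y ∷ ys) = trans (cong (not (any (y ≡ᵇ_) xs) ∧_) (apartᵇ-sym xs ys)) (sym (apartᵇ-∷ˡ y ys xs))

distinctᵇ-++ : ∀ xs ys → distinctᵇ (xs ++ ys) ≡ distinctᵇ xs ∧ (distinctᵇ ys ∧ apartᵇ xs ys)
distinctᵇ-++ []       ys = sym (trans (cong (distinctᵇ ys ∧_) (all-true ys (λ _ → refl))) (∧-identityʳ _))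
distinctᵇ-++ (x ∷ xs) ys = begin
  not (any (x ≡ᵇ_) (xs ++ ys)) ∧ distinctᵇ (xs ++ ys)
    ≡⟨ cong₂ _∧_ (trans (cong not (any-++ (x ≡ᵇ_) xs ys)) (not-∨ (any (x ≡ᵇ_) xs) _)) (distinctᵇ-++ xs ys) ⟩
  (not (any (x ≡ᵇ_) xs) ∧ not (any (x ≡ᵇ_) ys)) ∧ (distinctᵇ xs ∧ (distinctᵇ ys ∧ apartᵇ xs ys))
    ≡⟨ regroup (not (any (x ≡ᵇ_) xs)) _ (distinctᵇ xs) (distinctᵇ ys) (apartᵇ xs ys) ⟩
  (not (any (x ≡ᵇ_) xs) ∧ distinctᵇ xs) ∧ (distinctᵇ ys ∧ (not (any (x ≡ᵇ_) ys) ∧ apartᵇ xs ys))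
    ≡⟨ cong (λ z → (not (any (x ≡ᵇ_) xs) ∧ distinctᵇ xs) ∧ (distinctᵇ ys ∧ z)) (sym (apartᵇ-∷ˡ x xs ys)) ⟩
  distinctᵇ (x ∷ xs) ∧ (distinctᵇ ys ∧ apartᵇ (x ∷ xs) ys)  ∎
  where
  open ≡-Reasoning
  regroup : ∀ a b c d e → (a ∧ b) ∧ (c ∧ (d ∧ e)) ≡ (a ∧ c) ∧ (d ∧ (b ∧ e))
  regroup = solve 5 (λ a b c d e → (a ∧′ b) ∧′ (c ∧′ (d ∧′ e)) ⊜ (a ∧′ c) ∧′ (d ∧′ (b ∧′ e))) refl

distinctᵇ-swap : ∀ xs ys zs → distinctᵇ (xs ++ ys ++ zs) ≡ distinctᵇ (ys ++ xs ++ zs)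
distinctᵇ-swap xs ys zs = begin
  distinctᵇ (xs ++ ys ++ zs)
    ≡⟨ trans (distinctᵇ-++ xs (ys ++ zs))
             (cong₂ (λ u v → distinctᵇ xs ∧ (u ∧ v)) (distinctᵇ-++ ys zs) (all-++ _ ys zs)) ⟩
  distinctᵇ xs ∧ ((distinctᵇ ys ∧ (distinctᵇ zs ∧ apartᵇ ys zs)) ∧ (apartᵇ xs ys ∧ apartᵇ xs zs))
    ≡⟨ regroup (distinctᵇ xs) (distinctᵇ ys) (distinctᵇ zs) (apartᵇ ys zs) (apartᵇ xs ys) (apartᵇ xs zs) ⟩
  distinctᵇ ys ∧ ((distinctᵇ xs ∧ (distinctᵇ zs ∧ apartᵇ xs zs)) ∧ (apartᵇ xs ys ∧ apartᵇ ys zs))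
    ≡⟨ sym (trans (distinctᵇ-++ ys (xs ++ zs))
                  (cong₂ (λ u v → distinctᵇ ys ∧ (u ∧ v)) (distinctᵇ-++ xs zs)
                         (trans (all-++ _ xs zs) (cong (_∧ apartᵇ ys zs) (apartᵇ-sym ys xs))))) ⟩
  distinctᵇ (ys ++ xs ++ zs)  ∎
  where
  open ≡-Reasoning
  regroup : ∀ a b c d e f → a ∧ ((b ∧ (c ∧ d)) ∧ (e ∧ f)) ≡ b ∧ ((a ∧ (c ∧ f)) ∧ (e ∧ d))
  regroup = solve 6 (λ a b c d e f →
    a ∧′ ((b ∧′ (c ∧′ d)) ∧′ (e ∧′ f)) ⊜ b ∧′ ((a ∧′ (c ∧′ f)) ∧′ (e ∧′ d))) refl

distinctᵇ-map : ∀ (f g : A → ℕ) → (∀ a b → (f a ≡ᵇ f b) ≡ (g a ≡ᵇ g b)) →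
  ∀ xs → distinctᵇ (map f xs) ≡ distinctᵇ (map g xs)
distinctᵇ-map f g f≈g []       = refl
distinctᵇ-map f g f≈g (x ∷ xs) = cong₂ _∧_
  (cong not (trans (any-map (f x ≡ᵇ_) f xs) (trans (any-cong xs (f≈g x)) (sym (any-map (g x ≡ᵇ_) g xs)))))
  (distinctᵇ-map f g f≈g xs)

count : ∀ {N} → (Fin N → Bool) → ℕ
count {zero}  p = 0
count {suc N} p = if p Fin.zero then suc (count (p ∘ Fin.suc)) else count (p ∘ Fin.suc)

count-false : ∀ N → count {N} (λ _ → false) ≡ 0
count-false zero    = refl
count-false (suc N) = count-false N

count-+-count-not : ∀ {N} (p : Fin N → Bool) → count p ℕ.+ count (not ∘ p) ≡ N
count-+-count-not {zero}  p = refl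
count-+-count-not {suc N} p with p Fin.zero
... | true  = cong suc (count-+-count-not (p ∘ Fin.suc))
... | false = trans (ℕ.+-suc _ _) (cong suc (count-+-count-not (p ∘ Fin.suc)))

count-∨ : ∀ {N} (p q : Fin N → Bool) → (∀ v → p v ∧ q v ≡ false) →
  count (λ v → p v ∨ q v) ≡ count p ℕ.+ count q
count-∨ {zero}  p q disj = refl
count-∨ {suc N} p q disj with p Fin.zero | q Fin.zero | disj Fin.zero
... | true  | false | _ = cong suc (count-∨ (p ∘ Fin.suc) (q ∘ Fin.suc) (disj ∘ Fin.suc))
... | false | true  | _ = trans (cong suc (count-∨ (p ∘ Fin.suc) (q ∘ Fin.suc) (disj ∘ Fin.suc)))
                                (sym (ℕ.+-suc _ _))
... | false | false | _ = count-∨ (p ∘ Fin.suc) (q ∘ Fin.suc) (disj ∘ Fin.suc)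

count-≡ᵇ : ∀ {N} d → d < N → count {N} (λ v → toℕ v ≡ᵇ d) ≡ 1
count-≡ᵇ {suc N} zero    _         = cong suc (count-false N)
count-≡ᵇ {suc N} (suc d) (s≤s d<N) = count-≡ᵇ d d<N

count-any : ∀ {N} D → distinctᵇ D ≡ true → all (_<ᵇ N) D ≡ true →
  count {N} (λ v → any (toℕ v ≡ᵇ_) D) ≡ length D
count-any {N} []      _     _     = count-false N
count-any {N} (d ∷ D) dist  bound = begin
  count {N} (λ v → (toℕ v ≡ᵇ d) ∨ any (toℕ v ≡ᵇ_) D)
    ≡⟨ count-∨ (λ v → toℕ v ≡ᵇ d) (λ v → any (toℕ v ≡ᵇ_) D) apart ⟩
  count {N} (λ v → toℕ v ≡ᵇ d) ℕ.+ count {N} (λ v → any (toℕ v ≡ᵇ_) D)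
    ≡⟨ cong₂ ℕ._+_ (count-≡ᵇ {N} d (<ᵇ⇒< (∧≡true⇒ˡ {b = all (_<ᵇ N) D} bound)))
                   (count-any {N} D (∧≡true⇒ʳ dist) (∧≡true⇒ʳ {d <ᵇ N} bound)) ⟩
  suc (length D)                                                  ∎
  where
  open ≡-Reasoning
  apart : ∀ (v : Fin N) → (toℕ v ≡ᵇ d) ∧ any (toℕ v ≡ᵇ_) D ≡ false
  apart v with toℕ v ≡ᵇ d in v≡d
  ... | true  rewrite ≡ᵇ⇒≡ (toℕ v) d v≡d = not≡true⇒ (∧≡true⇒ˡ dist)
  ... | false = refl

length-filterᵇ-pathSets : ∀ N t (φ : List (Path N t) → Bool) →
  + length (filterᵇ φ (pathSets N t)) ≡ sumSubsets (tPaths N t) (⟦_⟧ ∘ φ)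
length-filterᵇ-pathSets N t φ = begin
  + length (filterᵇ φ (pathSets N t))                ≡⟨ length-filterᵇ φ (pathSets N t) ⟩
  ∑ (⟦_⟧ ∘ φ) (map (selected P) (allBoolLists ∣P∣))  ≡⟨ ∑-map (⟦_⟧ ∘ φ) (selected P) (allBoolLists ∣P∣) ⟩
  ∑ (⟦_⟧ ∘ φ ∘ selected P) (allBoolLists ∣P∣)        ≡⟨ ∑-selected P (⟦_⟧ ∘ φ) ⟩
  sumSubsets P (⟦_⟧ ∘ φ)                             ∎
  where
  open ≡-Reasoning
  P = tPaths N t
  ∣P∣ = length P

tPaths-0 : ∀ t → tPaths 0 t ≡ []
tPaths-0 t = cong (filterᵇ isPathRepᵇ) (concatMap-[] (allVecs 0 t))
  where
  concatMap-[] : ∀ (xs : List A) → concatMap (λ _ → []) xs ≡ ([] {A = B})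
  concatMap-[] []       = refl
  concatMap-[] (x ∷ xs) = concatMap-[] xs

eval-hermite : ∀ w t n → eval w (hermite t n) ≡
  sumSubsets (tPaths n t) (λ S → ⟦ disjointᵇ S ⟧ * (sign (length S) * w (n ∸ suc t ℕ.* length S)))
eval-hermite w t n = begin
  eval w (foldr _⊕_ [] (map term D))                 ≡⟨ eval-foldr-⊕ w (map term D) ⟩
  ∑ (eval w) (map term D)                            ≡⟨ ∑-map (eval w) term D ⟩
  ∑ (eval w ∘ term) D                                ≡⟨ ∑-filterᵇ (eval w ∘ term) disjointᵇ (pathSets n t) ⟩
  ∑ f (map (selected P) (allBoolLists (length P)))   ≡⟨ ∑-map f (selected P) (allBoolLists (length P)) ⟩
  ∑ (f ∘ selected P) (allBoolLists (length P))       ≡⟨ ∑-selected P f ⟩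
  sumSubsets P f                                     ≡⟨ sumSubsets-cong P (λ S → cong (⟦ disjointᵇ S ⟧ *_)
                                                          (eval-monomial w (sign (length S)) (exponent S))) ⟩
  sumSubsets P (λ S → ⟦ disjointᵇ S ⟧ * (sign (length S) * w (exponent S)))  ∎
  where
  open ≡-Reasoning
  P = tPaths n t
  D = filterᵇ disjointᵇ (pathSets n t)
  exponent : List (Path n t) → ℕ
  exponent S = n ∸ suc t ℕ.* length S
  term : List (Path n t) → Poly
  term S = monomial (sign (length S)) (exponent S)
  f : List (Path n t) → ℤ
  f S = ⟦ disjointᵇ S ⟧ * eval w (term S)

isCoveringᵇ : ∀ {N t} → List (Path N t) → Bool
isCoveringᵇ S = disjointᵇ S ∧ coversᵇ S

disjointᵇ-insert : ∀ {N t} (x : Path N t) xs ys → disjointᵇ (x ∷ xs ++ ys) ≡ disjointᵇ (xs ++ x ∷ ys)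
disjointᵇ-insert x xs ys =
  trans (cong (λ vs → distinctᵇ (verts x ++ vs)) (List.concatMap-++ verts xs ys))
  (trans (distinctᵇ-swap (verts x) (concatMap verts xs) (concatMap verts ys))
         (sym (cong distinctᵇ (List.concatMap-++ verts xs (x ∷ ys)))))

coversᵇ-insert : ∀ {N t} (x : Path N t) xs ys → coversᵇ (x ∷ xs ++ ys) ≡ coversᵇ (xs ++ x ∷ ys)
coversᵇ-insert {N} x xs ys = all-cong (allFin N) (λ v →
  trans (cong (λ vs → any (toℕ v ≡ᵇ_) (verts x ++ vs)) (List.concatMap-++ verts xs ys))
  (trans (any-swap (toℕ v ≡ᵇ_) (verts x) (concatMap verts xs) (concatMap verts ys))
         (sym (cong (any (toℕ v ≡ᵇ_)) (List.concatMap-++ verts xs (x ∷ ys))))))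

isCoveringᵇ-insert : ∀ {N t} (x : Path N t) xs ys → isCoveringᵇ (x ∷ xs ++ ys) ≡ isCoveringᵇ (xs ++ x ∷ ys)
isCoveringᵇ-insert x xs ys = cong₂ _∧_ (disjointᵇ-insert x xs ys) (coversᵇ-insert x xs ys)

length-concatMap-verts : ∀ {N t} (S : List (Path N t)) → length (concatMap verts S) ≡ suc t ℕ.* length S
length-concatMap-verts {t = t} []      = sym (ℕ.*-zeroʳ (suc t))
length-concatMap-verts {t = t} (p ∷ S) =
  trans (List.length-++ (verts p))
        (trans (cong₂ ℕ._+_ (trans (List.length-map toℕ (Vec.toList p)) (Vec.length-toList p))
                            (length-concatMap-verts S))
               (sym (ℕ.*-suc (suc t) (length S))))

concatMap-verts-bounded : ∀ {N t} (S : List (Path N t)) → all (_<ᵇ N) (concatMap verts S) ≡ true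
concatMap-verts-bounded S = trans (all-concatMap _ verts S) (all-true S (λ p →
  trans (all-map _ toℕ (Vec.toList p)) (all-true (Vec.toList p) (λ v → <⇒<ᵇ (Fin.toℕ<n v)))))

coveredBy : ∀ {N t} → List (Path N t) → Fin N → Bool
coveredBy S v = any (toℕ v ≡ᵇ_) (concatMap verts S)

count-covered : ∀ {N t} (S : List (Path N t)) → disjointᵇ S ≡ true →
  count (coveredBy S) ≡ suc t ℕ.* length S
count-covered {N} S disj =
  trans (count-any {N} (concatMap verts S) disj (concatMap-verts-bounded S)) (length-concatMap-verts S)

count-uncovered : ∀ {N t} (S : List (Path N t)) → disjointᵇ S ≡ true →
  count (not ∘ coveredBy S) ≡ N ∸ suc t ℕ.* length S
count-uncovered {N} {t} S disj = begin
  count (not ∘ coveredBy S)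
    ≡⟨ ℕ.m+n∸m≡n (count (coveredBy S)) _ ⟨
  count (coveredBy S) ℕ.+ count (not ∘ coveredBy S) ∸ count (coveredBy S)
    ≡⟨ cong₂ _∸_ (count-+-count-not (coveredBy S)) (count-covered S disj) ⟩
  N ∸ suc t ℕ.* length S  ∎
  where open ≡-Reasoning

disjoint-bound : ∀ {N t} (S : List (Path N t)) → disjointᵇ S ≡ true → suc t ℕ.* length S ≤ N
disjoint-bound S disj = subst₂ _≤_ (count-covered S disj) (count-+-count-not (coveredBy S))
                               (ℕ.m≤m+n (count (coveredBy S)) _)

inside : ∀ {N k} → (Fin N → Bool) → Vec (Fin N) k → Bool
inside p v = all p (Vec.toList v)

-- Being increasing, e sends canonical path representatives (head < last) to canonical ones.
record IncreasingEnumeration {m N} (p : Fin N → Bool) (e : Fin m → Fin N) : Set where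
  field
    increasing : e Preserves Fin._<_ ⟶ Fin._<_
    image      : filterᵇ p (allFin N) ≡ map e (allFin m)
    selects    : ∀ i → p (e i) ≡ true

module _ {m N} {p : Fin N → Bool} {e : Fin m → Fin N} (en : IncreasingEnumeration p e) where
  open IncreasingEnumeration en

  ≡ᵇ-enum : ∀ i j → (toℕ (e i) ≡ᵇ toℕ (e j)) ≡ (toℕ i ≡ᵇ toℕ j)
  ≡ᵇ-enum i j with Fin.<-cmp i j
  ... | tri< i<j _ _    = trans (<⇒≢ᵇ (increasing i<j)) (sym (<⇒≢ᵇ i<j))
  ... | tri≈ _ refl _   = trans (≡ᵇ-refl (toℕ (e i))) (sym (≡ᵇ-refl (toℕ i)))
  ... | tri> _ _ j<i    = trans (≡ᵇ-sym (toℕ (e i)) _)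
                            (trans (<⇒≢ᵇ (increasing j<i)) (sym (trans (≡ᵇ-sym (toℕ i) _) (<⇒≢ᵇ j<i))))

  <ᵇ-enum : ∀ i j → (toℕ (e i) <ᵇ toℕ (e j)) ≡ (toℕ i <ᵇ toℕ j)
  <ᵇ-enum i j with Fin.<-cmp i j
  ... | tri< i<j _ _    = trans (<⇒<ᵇ (increasing i<j)) (sym (<⇒<ᵇ i<j))
  ... | tri≈ _ refl _   = trans (≤⇒≮ᵇ (ℕ.≤-refl {toℕ (e i)})) (sym (≤⇒≮ᵇ (ℕ.≤-refl {toℕ i})))
  ... | tri> _ _ j<i    = trans (≤⇒≮ᵇ (ℕ.<⇒≤ (increasing j<i))) (sym (≤⇒≮ᵇ (ℕ.<⇒≤ j<i)))

  verts-enum : ∀ {k} (v : Vec (Fin m) k) → map toℕ (Vec.toList (Vec.map e v)) ≡ map (toℕ ∘ e) (Vec.toList v)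
  verts-enum v = trans (cong (map toℕ) (Vec.toList-map e v)) (sym (List.map-∘ (Vec.toList v)))

  concatMap-verts-enum : ∀ {t} (S : List (Path m t)) →
    concatMap verts (map (Vec.map e) S) ≡ map (toℕ ∘ e) (concatMap Vec.toList S)
  concatMap-verts-enum S = trans (List.concatMap-map verts (Vec.map e) S)
    (trans (List.concatMap-cong verts-enum S) (sym (List.map-concatMap (toℕ ∘ e) Vec.toList S)))

  isPathRepᵇ-enum : ∀ {t} (v : Path m t) → isPathRepᵇ (Vec.map e v) ≡ isPathRepᵇ v
  isPathRepᵇ-enum (x Vec.∷ v) = cong₂ _∧_
    (trans (cong distinctᵇ (verts-enum (x Vec.∷ v))) (distinctᵇ-map (toℕ ∘ e) toℕ ≡ᵇ-enum (x ∷ Vec.toList v)))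
    (trans (cong (λ z → toℕ (e x) <ᵇ toℕ z) (last-map e (x Vec.∷ v))) (<ᵇ-enum x (Vec.last (x Vec.∷ v))))

  disjointᵇ-enum : ∀ {t} (S : List (Path m t)) → disjointᵇ (map (Vec.map e) S) ≡ disjointᵇ S
  disjointᵇ-enum S = trans (cong distinctᵇ (concatMap-verts-enum S))
    (trans (distinctᵇ-map (toℕ ∘ e) toℕ ≡ᵇ-enum (concatMap Vec.toList S))
           (cong distinctᵇ (List.map-concatMap toℕ Vec.toList S)))

  inside-enum : ∀ {k} (v : Vec (Fin m) k) → inside p (Vec.map e v) ≡ true
  inside-enum v = trans (cong (all p) (Vec.toList-map e v))
                        (trans (all-map p e (Vec.toList v)) (all-true (Vec.toList v) selects))

  any-≡ᵇ-enum : ∀ i is → any (toℕ (e i) ≡ᵇ_) (map (toℕ ∘ e) is) ≡ any (toℕ i ≡ᵇ_) (map toℕ is)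
  any-≡ᵇ-enum i is = trans (any-map _ (toℕ ∘ e) is) (trans (any-cong is (≡ᵇ-enum i)) (sym (any-map _ toℕ is)))

  allVecs-inside : ∀ k → filterᵇ (inside p) (allVecs N k) ≡ map (Vec.map e) (allVecs m k)
  allVecs-inside zero    = refl
  allVecs-inside (suc k) = begin
    filterᵇ (inside p) (concatMap (extend N) (allVecs N k))
      ≡⟨ filterᵇ-concatMap (inside p) (extend N) (allVecs N k) ⟩
    concatMap (filterᵇ (inside p) ∘ extend N) (allVecs N k)
      ≡⟨ List.concatMap-cong extend-inside (allVecs N k) ⟩
    concatMap (λ v → if inside p v then map (Vec._∷ v) (map e (allFin m)) else []) (allVecs N k)
      ≡⟨ concatMap-filterᵇ (λ v → map (Vec._∷ v) (map e (allFin m))) (inside p) (allVecs N k) ⟨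
    concatMap (λ v → map (Vec._∷ v) (map e (allFin m))) (filterᵇ (inside p) (allVecs N k))
      ≡⟨ cong (concatMap (λ v → map (Vec._∷ v) (map e (allFin m)))) (allVecs-inside k) ⟩
    concatMap (λ v → map (Vec._∷ v) (map e (allFin m))) (map (Vec.map e) (allVecs m k))
      ≡⟨ List.concatMap-map _ (Vec.map e) (allVecs m k) ⟩
    concatMap (λ w → map (Vec._∷ Vec.map e w) (map e (allFin m))) (allVecs m k)
      ≡⟨ List.concatMap-cong (λ w → trans (sym (List.map-∘ (allFin m))) (List.map-∘ (allFin m)))
                             (allVecs m k) ⟩
    concatMap (map (Vec.map e) ∘ extend m) (allVecs m k)
      ≡⟨ List.map-concatMap (Vec.map e) (extend m) (allVecs m k) ⟨
    map (Vec.map e) (concatMap (extend m) (allVecs m k))  ∎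
    where
    open ≡-Reasoning
    extend : ∀ n → Vec (Fin n) k → List (Vec (Fin n) (suc k))
    extend n v = map (Vec._∷ v) (allFin n)
    extend-inside : ∀ v → filterᵇ (inside p) (extend N v) ≡
                          (if inside p v then map (Vec._∷ v) (map e (allFin m)) else [])
    extend-inside v rewrite filterᵇ-map (inside p) (Vec._∷ v) (allFin N) with inside p v
    ... | true  = cong (map (Vec._∷ v)) (trans (filterᵇ-cong (allFin N) (λ a → ∧-identityʳ (p a))) image)
    ... | false = cong (map (Vec._∷ v)) (trans (filterᵇ-cong (allFin N) (λ a → ∧-zeroʳ (p a)))
                                                (filterᵇ-false (allFin N)))

  tPaths-inside : ∀ t → filterᵇ (inside p) (tPaths N t) ≡ map (Vec.map e) (tPaths m t)
  tPaths-inside t = begin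
    filterᵇ (inside p) (filterᵇ isPathRepᵇ (allVecs N (suc t)))
      ≡⟨ filterᵇ-comm (inside p) isPathRepᵇ (allVecs N (suc t)) ⟩
    filterᵇ isPathRepᵇ (filterᵇ (inside p) (allVecs N (suc t)))
      ≡⟨ cong (filterᵇ isPathRepᵇ) (allVecs-inside (suc t)) ⟩
    filterᵇ isPathRepᵇ (map (Vec.map e) (allVecs m (suc t)))
      ≡⟨ filterᵇ-map isPathRepᵇ (Vec.map e) (allVecs m (suc t)) ⟩
    map (Vec.map e) (filterᵇ (isPathRepᵇ ∘ Vec.map e) (allVecs m (suc t)))
      ≡⟨ cong (map (Vec.map e)) (filterᵇ-cong (allVecs m (suc t)) isPathRepᵇ-enum) ⟩
    map (Vec.map e) (tPaths m t)  ∎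
    where open ≡-Reasoning

↑ˡ-enumeration : ∀ n N′ → IncreasingEnumeration (λ v → toℕ v <ᵇ n) (Fin._↑ˡ N′)
↑ˡ-enumeration n N′ = record { increasing = increasing ; image = image n ; selects = selects }
  where
  increasing : (Fin._↑ˡ N′) Preserves Fin._<_ ⟶ Fin._<_
  increasing {i} {j} i<j rewrite Fin.toℕ-↑ˡ i N′ | Fin.toℕ-↑ˡ j N′ = i<j
  image : ∀ k → filterᵇ (λ v → toℕ v <ᵇ k) (allFin (k ℕ.+ N′)) ≡ map (Fin._↑ˡ N′) (allFin k)
  image zero    = filterᵇ-false (allFin N′)
  image (suc k) = begin
    filterᵇ (λ v → toℕ v <ᵇ suc k) (allFin (suc k ℕ.+ N′))
      ≡⟨ cong (filterᵇ (λ v → toℕ v <ᵇ suc k)) (allFin-suc (k ℕ.+ N′)) ⟩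
    Fin.zero ∷ filterᵇ (λ v → toℕ v <ᵇ suc k) (map Fin.suc (allFin (k ℕ.+ N′)))
      ≡⟨ cong (Fin.zero ∷_) (filterᵇ-map _ Fin.suc (allFin (k ℕ.+ N′))) ⟩
    Fin.zero ∷ map Fin.suc (filterᵇ (λ v → toℕ v <ᵇ k) (allFin (k ℕ.+ N′)))
      ≡⟨ cong (λ vs → Fin.zero ∷ map Fin.suc vs) (image k) ⟩
    Fin.zero ∷ map Fin.suc (map (Fin._↑ˡ N′) (allFin k))
      ≡⟨ cong (Fin.zero ∷_) (trans (sym (List.map-∘ (allFin k))) (List.map-∘ (allFin k))) ⟩
    map (Fin._↑ˡ N′) (Fin.zero ∷ map Fin.suc (allFin k))
      ≡⟨ cong (map (Fin._↑ˡ N′)) (allFin-suc k) ⟨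
    map (Fin._↑ˡ N′) (allFin (suc k))  ∎
    where open ≡-Reasoning
  selects : ∀ i → (toℕ (i Fin.↑ˡ N′) <ᵇ n) ≡ true
  selects i rewrite Fin.toℕ-↑ˡ i N′ = <⇒<ᵇ (Fin.toℕ<n i)

↑ʳ-enumeration : ∀ n N′ → IncreasingEnumeration {N′} (λ v → not (toℕ v <ᵇ n)) (n Fin.↑ʳ_)
↑ʳ-enumeration n N′ = record { increasing = increasing ; image = image n ; selects = selects }
  where
  increasing : (n Fin.↑ʳ_) Preserves Fin._<_ ⟶ Fin._<_
  increasing {i} {j} i<j rewrite Fin.toℕ-↑ʳ n i | Fin.toℕ-↑ʳ n j = ℕ.+-monoʳ-< n i<j
  image : ∀ k → filterᵇ (λ v → not (toℕ v <ᵇ k)) (allFin (k ℕ.+ N′)) ≡ map (k Fin.↑ʳ_) (allFin N′)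
  image zero    = trans (filterᵇ-true (allFin N′)) (sym (List.map-id (allFin N′)))
  image (suc k) = begin
    filterᵇ (λ v → not (toℕ v <ᵇ suc k)) (allFin (suc k ℕ.+ N′))
      ≡⟨ cong (filterᵇ (λ v → not (toℕ v <ᵇ suc k))) (allFin-suc (k ℕ.+ N′)) ⟩
    filterᵇ (λ v → not (toℕ v <ᵇ suc k)) (map Fin.suc (allFin (k ℕ.+ N′)))
      ≡⟨ filterᵇ-map _ Fin.suc (allFin (k ℕ.+ N′)) ⟩
    map Fin.suc (filterᵇ (λ v → not (toℕ v <ᵇ k)) (allFin (k ℕ.+ N′)))
      ≡⟨ cong (map Fin.suc) (image k) ⟩
    map Fin.suc (map (k Fin.↑ʳ_) (allFin N′))
      ≡⟨ List.map-∘ (allFin N′) ⟨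
    map (suc k Fin.↑ʳ_) (allFin N′)  ∎
    where open ≡-Reasoning
  selects : ∀ i → not (toℕ (n Fin.↑ʳ i) <ᵇ n) ≡ true
  selects i rewrite Fin.toℕ-↑ʳ n i | ≤⇒≮ᵇ (ℕ.m≤m+n n (toℕ i)) = refl

enumerate : ∀ {N} (p : Fin N → Bool) → Fin (count p) → Fin N
enumerate {suc N} p i with p Fin.zero
enumerate {suc N} p Fin.zero    | true  = Fin.zero
enumerate {suc N} p (Fin.suc i) | true  = Fin.suc (enumerate (p ∘ Fin.suc) i)
enumerate {suc N} p i           | false = Fin.suc (enumerate (p ∘ Fin.suc) i)

enumerate-increasing : ∀ {N} (p : Fin N → Bool) → enumerate p Preserves Fin._<_ ⟶ Fin._<_
enumerate-increasing {suc N} p {i} {j} i<j with p Fin.zero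
enumerate-increasing {suc N} p {Fin.zero}  {Fin.suc j} i<j       | true  = s≤s z≤n
enumerate-increasing {suc N} p {Fin.suc i} {Fin.suc j} (s≤s i<j) | true  =
  s≤s (enumerate-increasing (p ∘ Fin.suc) i<j)
enumerate-increasing {suc N} p {i}         {j}         i<j       | false =
  s≤s (enumerate-increasing (p ∘ Fin.suc) i<j)

enumerate-selects : ∀ {N} (p : Fin N → Bool) i → p (enumerate p i) ≡ true
enumerate-selects {suc N} p i with p Fin.zero in p0
enumerate-selects {suc N} p Fin.zero    | true  = p0
enumerate-selects {suc N} p (Fin.suc i) | true  = enumerate-selects (p ∘ Fin.suc) i
enumerate-selects {suc N} p i           | false = enumerate-selects (p ∘ Fin.suc) i

enumerate-image : ∀ {N} (p : Fin N → Bool) → filterᵇ p (allFin N) ≡ map (enumerate p) (allFin (count p))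
enumerate-image {zero}  p = refl
enumerate-image {suc N} p = begin
  filterᵇ p (allFin (suc N))
    ≡⟨ cong (filterᵇ p) (allFin-suc N) ⟩
  filterᵇ p (Fin.zero ∷ map Fin.suc (allFin N))
    ≡⟨ filterᵇ-∷ p Fin.zero (map Fin.suc (allFin N)) ⟩
  (if p Fin.zero then Fin.zero ∷ filterᵇ p (map Fin.suc (allFin N)) else filterᵇ p (map Fin.suc (allFin N)))
    ≡⟨ cong (λ xs → if p Fin.zero then Fin.zero ∷ xs else xs)
            (trans (filterᵇ-map p Fin.suc (allFin N)) (cong (map Fin.suc) (enumerate-image (p ∘ Fin.suc)))) ⟩
  (if p Fin.zero then Fin.zero ∷ map Fin.suc rest else map Fin.suc rest)
    ≡⟨ shift ⟩
  map (enumerate p) (allFin (count p))  ∎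
  where
  open ≡-Reasoning
  rest = map (enumerate (p ∘ Fin.suc)) (allFin (count (p ∘ Fin.suc)))
  shift : (if p Fin.zero then Fin.zero ∷ map Fin.suc rest else map Fin.suc rest) ≡
          map (enumerate p) (allFin (count p))
  shift with p Fin.zero
  ... | true  = cong (Fin.zero ∷_) (trans (sym (List.map-∘ (allFin (count (p ∘ Fin.suc)))))
                                          (trans (List.map-tabulate (λ i → i) _)
                                                 (sym (List.map-tabulate Fin.suc _))))
  ... | false = sym (List.map-∘ (allFin (count (p ∘ Fin.suc))))

enumeration : ∀ {N} (p : Fin N → Bool) → IncreasingEnumeration p (enumerate p)
enumeration p = record
  { increasing = enumerate-increasing p ; image = enumerate-image p ; selects = enumerate-selects p }

heads-covered : ∀ {N t} (U : List ℕ) (T : List (Path N t)) →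
  all (λ p → any (toℕ (Vec.head p) ≡ᵇ_) (U ++ concatMap verts T)) T ≡ true
heads-covered U []                  = refl
heads-covered U (p@(x Vec.∷ _) ∷ T) = cong₂ _∧_ head-covered
  (trans (all-cong T (λ q → cong (any (toℕ (Vec.head q) ≡ᵇ_))
                                 (sym (List.++-assoc U (verts p) (concatMap verts T)))))
         (heads-covered (U ++ verts p) T))
  where
  head-covered : any (toℕ x ≡ᵇ_) (U ++ verts p ++ concatMap verts T) ≡ true
  head-covered rewrite any-++ (toℕ x ≡ᵇ_) U (verts p ++ concatMap verts T) | ≡ᵇ-refl (toℕ x) =
    ∨-zeroʳ (any (toℕ x ≡ᵇ_) U)

module _ {N t : ℕ} (T : List (Path N t)) where

  uncovered : Fin N → Bool
  uncovered = not ∘ coveredBy T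

  disjointᵇ-++ : ∀ X → disjointᵇ (T ++ X) ≡ disjointᵇ T ∧ (disjointᵇ X ∧ all (inside uncovered) X)
  disjointᵇ-++ X =
    trans (cong distinctᵇ (List.concatMap-++ verts T X))
          (trans (distinctᵇ-++ (concatMap verts T) (concatMap verts X))
                 (cong (λ b → disjointᵇ T ∧ (disjointᵇ X ∧ b))
                       (trans (all-concatMap _ verts X) (all-cong X (λ p → all-map _ toℕ (Vec.toList p))))))

  paths-not-inside : all (not ∘ inside uncovered) T ≡ true
  paths-not-inside = all-mono T head-covered (heads-covered [] T)
    where
    head-covered : ∀ p → coveredBy T (Vec.head p) ≡ true → not (inside uncovered p) ≡ true
    head-covered (x Vec.∷ xs) covered rewrite covered = refl

  private
    e = enumerate uncovered
    en = enumeration uncovered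
    open IncreasingEnumeration en

  coversᵇ-++-enum : ∀ X → coversᵇ (T ++ map (Vec.map e) X) ≡ coversᵇ X
  coversᵇ-++-enum X = begin
    all (λ v → any (toℕ v ≡ᵇ_) (concatMap verts (T ++ map (Vec.map e) X))) (allFin N)
      ≡⟨ all-cong (allFin N) (λ v → trans (cong (any (toℕ v ≡ᵇ_)) (List.concatMap-++ verts T _))
                                           (any-++ (toℕ v ≡ᵇ_) (concatMap verts T) _)) ⟩
    all covered-by-T∪X (allFin N)
      ≡⟨ all-filterᵇ uncovered covered-by-T∪X (allFin N) covered-by-T ⟩
    all covered-by-T∪X (filterᵇ uncovered (allFin N))
      ≡⟨ cong (all covered-by-T∪X) image ⟩
    all covered-by-T∪X (map e (allFin (count uncovered)))
      ≡⟨ all-map covered-by-T∪X e (allFin (count uncovered)) ⟩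
    all (covered-by-T∪X ∘ e) (allFin (count uncovered))
      ≡⟨ all-cong (allFin (count uncovered)) covered-by-X ⟩
    coversᵇ X  ∎
    where
    open ≡-Reasoning
    covered-by-T∪X : Fin N → Bool
    covered-by-T∪X v = coveredBy T v ∨ coveredBy (map (Vec.map e) X) v
    covered-by-T : ∀ v → uncovered v ≡ false → covered-by-T∪X v ≡ true
    covered-by-T v v-covered with any (toℕ v ≡ᵇ_) (concatMap verts T)
    ... | true = refl
    covered-by-X : ∀ i → covered-by-T∪X (e i) ≡ any (toℕ i ≡ᵇ_) (concatMap verts X)
    covered-by-X i = begin
      covered-by-T∪X (e i)
        ≡⟨ cong₂ _∨_ (not≡true⇒ (selects i)) (cong (any (toℕ (e i) ≡ᵇ_)) (concatMap-verts-enum en X)) ⟩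
      any (toℕ (e i) ≡ᵇ_) (map (toℕ ∘ e) (concatMap Vec.toList X))
        ≡⟨ any-≡ᵇ-enum en i (concatMap Vec.toList X) ⟩
      any (toℕ i ≡ᵇ_) (map toℕ (concatMap Vec.toList X))
        ≡⟨ cong (any (toℕ i ≡ᵇ_)) (List.map-concatMap toℕ Vec.toList X) ⟩
      any (toℕ i ≡ᵇ_) (concatMap verts X)  ∎

  isCoveringᵇ-++-enum : disjointᵇ T ≡ true → ∀ X → isCoveringᵇ (T ++ map (Vec.map e) X) ≡ isCoveringᵇ X
  isCoveringᵇ-++-enum disjT X = cong₂ _∧_ disjoint (coversᵇ-++-enum X)
    where
    disjoint : disjointᵇ (T ++ map (Vec.map e) X) ≡ disjointᵇ X
    disjoint rewrite disjointᵇ-++ (map (Vec.map e) X) | disjT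
                   | all-map (inside uncovered) (Vec.map e) X | all-true X (inside-enum en)
                   | disjointᵇ-enum en X = ∧-identityʳ (disjointᵇ X)

  -- A covering that contains the disjoint set T is T together with a covering of the uncovered
  -- vertices, and those correspond to coverings of K_{count uncovered} through the enumeration e.
  sum-coverings-extending : ∀ {R} → Split (tPaths N t) T R →
    sumSubsets R (λ X → ⟦ isCoveringᵇ (T ++ X) ⟧) ≡ ⟦ disjointᵇ T ⟧ * + μ t (N ∸ suc t ℕ.* length T)
  sum-coverings-extending {R} split with disjointᵇ T in disjT
  ... | false = trans (sumSubsets-cong R (λ X → cong (λ b → ⟦ b ∧ coversᵇ (T ++ X) ⟧)
                        (trans (disjointᵇ-++ X) (cong (_∧ (disjointᵇ X ∧ all (inside uncovered) X)) disjT))))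
                      (sumSubsets-0 R)
  ... | true = begin
    sumSubsets R (λ X → ⟦ isCoveringᵇ (T ++ X) ⟧)
      ≡⟨ sumSubsets-restrict (inside uncovered) R _ outside-vanishes ⟩
    sumSubsets (filterᵇ (inside uncovered) R) (λ X → ⟦ isCoveringᵇ (T ++ X) ⟧)
      ≡⟨ cong (λ P → sumSubsets P (λ X → ⟦ isCoveringᵇ (T ++ X) ⟧))
              (trans (filterᵇ-Split (inside uncovered) split paths-not-inside) (tPaths-inside en t)) ⟩
    sumSubsets (map (Vec.map e) (tPaths (count uncovered) t)) (λ X → ⟦ isCoveringᵇ (T ++ X) ⟧)
      ≡⟨ sumSubsets-map (Vec.map e) (tPaths (count uncovered) t) _ ⟩
    sumSubsets (tPaths (count uncovered) t) (λ X → ⟦ isCoveringᵇ (T ++ map (Vec.map e) X) ⟧)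
      ≡⟨ sumSubsets-cong (tPaths (count uncovered) t) (cong ⟦_⟧ ∘ isCoveringᵇ-++-enum disjT) ⟩
    sumSubsets (tPaths (count uncovered) t) (⟦_⟧ ∘ isCoveringᵇ)
      ≡⟨ length-filterᵇ-pathSets (count uncovered) t isCoveringᵇ ⟨
    + μ t (count uncovered)
      ≡⟨ cong (+_ ∘ μ t) (count-uncovered T disjT) ⟩
    + μ t (N ∸ suc t ℕ.* length T)
      ≡⟨ ℤ.*-identityˡ _ ⟨
    + 1 * + μ t (N ∸ suc t ℕ.* length T)  ∎
    where
    open ≡-Reasoning
    outside-vanishes : ∀ X → all (inside uncovered) X ≡ false → ⟦ isCoveringᵇ (T ++ X) ⟧ ≡ + 0
    outside-vanishes X outside rewrite disjointᵇ-++ X | disjT | outside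
                                     | ∧-zeroʳ (disjointᵇ X) = refl

sumNested-coverings : ∀ {N t} (c : List (Path N t) → ℤ) →
  sumNested (tPaths N t) (λ T S → c T * ⟦ isCoveringᵇ S ⟧) ≡
  sumSubsets (tPaths N t) (λ T → c T * (⟦ disjointᵇ T ⟧ * + μ t (N ∸ suc t ℕ.* length T)))
sumNested-coverings {N} {t} c = begin
  sumNested P (λ T S → c T * ⟦ isCoveringᵇ S ⟧)
    ≡⟨ sumNested-by-splits P _ (λ T x as bs → cong (λ b → c T * ⟦ b ⟧) (isCoveringᵇ-insert x as bs)) ⟩
  sumSplits P (λ T R → sumSubsets R (λ X → c T * ⟦ isCoveringᵇ (T ++ X) ⟧))
    ≡⟨ sumSplits-cong P (λ T R split → trans (sumSubsets-* R (c T) _)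
                                             (cong (c T *_) (sum-coverings-extending T split))) ⟩
  sumSplits P (λ T _ → c T * (⟦ disjointᵇ T ⟧ * + μ t (N ∸ suc t ℕ.* length T)))
    ≡⟨ sumSplits-fst P _ ⟩
  sumSubsets P (λ T → c T * (⟦ disjointᵇ T ⟧ * + μ t (N ∸ suc t ℕ.* length T)))  ∎
  where
  open ≡-Reasoning
  P = tPaths N t

-- Products of Hermite polynomials

blockOf-< : ∀ n ns w → (w <ᵇ n) ≡ true → blockOf (n ∷ ns) w ≡ 0
blockOf-< n ns w w<n rewrite w<n = refl

blockOf-+ : ∀ n ns i → blockOf (n ∷ ns) (n ℕ.+ i) ≡ suc (blockOf ns i)
blockOf-+ n ns i rewrite ≤⇒≮ᵇ (ℕ.m≤m+n n i) | ℕ.m+n∸m≡n n i = refl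

same-block⇒same-side : ∀ n ns w x → (blockOf (n ∷ ns) w ≡ᵇ blockOf (n ∷ ns) x) ≡ true → (w <ᵇ n) ≡ (x <ᵇ n)
same-block⇒same-side n ns w x same with w <ᵇ n | x <ᵇ n
... | true  | true  = refl
... | false | false = refl

sign-+ : ∀ a b → sign (a ℕ.+ b) ≡ sign a * sign b
sign-+ zero    b = sym (ℤ.*-identityˡ (sign b))
sign-+ (suc a) b = trans (cong -_ (sign-+ a b)) (ℤ.neg-distribˡ-* (sign a) (sign b))

+-∸-+ : ∀ {a b} m n → a ≤ m → b ≤ n → (m ℕ.+ n) ∸ (a ℕ.+ b) ≡ (m ∸ a) ℕ.+ (n ∸ b)
+-∸-+ {a} {b} m n a≤m b≤n = begin
  (m ℕ.+ n) ∸ (a ℕ.+ b)   ≡⟨ ℕ.∸-+-assoc (m ℕ.+ n) a b ⟨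
  (m ℕ.+ n) ∸ a ∸ b       ≡⟨ cong (_∸ b) (ℕ.+-∸-comm n a≤m) ⟩
  (m ∸ a) ℕ.+ n ∸ b       ≡⟨ ℕ.+-∸-assoc (m ∸ a) b≤n ⟩
  (m ∸ a) ℕ.+ (n ∸ b)     ∎
  where open ≡-Reasoning

hermiteProductTerm : ∀ t ns → (ℕ → ℤ) → List (Path (sum ns) t) → ℤ
hermiteProductTerm t ns w S =
  ⟦ disjointᵇ S ∧ all (homogeneousᵇ ns) S ⟧ * (sign (length S) * w (sum ns ∸ suc t ℕ.* length S))

hermiteProductTerm-inhomogeneous : ∀ t ns {w} S → all (homogeneousᵇ ns) S ≡ false →
  hermiteProductTerm t ns w S ≡ + 0
hermiteProductTerm-inhomogeneous t ns S inhom rewrite inhom | ∧-zeroʳ (disjointᵇ S) = refl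

hermiteProductTerm-insertionInvariant : ∀ t ns w → InsertionInvariant (hermiteProductTerm t ns w)
hermiteProductTerm-insertionInvariant t ns w x as bs =
  cong₂ (λ b l → ⟦ b ⟧ * (sign l * w (sum ns ∸ suc t ℕ.* l)))
        (cong₂ _∧_ (disjointᵇ-insert x as bs) (all-insert (homogeneousᵇ ns) x as bs))
        (sym (List.length-++-sucʳ as x bs))

module HermiteProduct (t n : ℕ) (ns : List ℕ) where

  N′ = sum ns
  N  = n ℕ.+ N′

  left : Fin N → Bool
  left v = toℕ v <ᵇ n

  right : Fin N → Bool
  right v = not (toℕ v <ᵇ n)

  eL : Fin n → Fin N
  eL = Fin._↑ˡ N′

  eR : Fin N′ → Fin N
  eR = n Fin.↑ʳ_

  homogeneous : Path N t → Bool
  homogeneous = homogeneousᵇ (n ∷ ns)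

  Hom′ : List (Path N′ t)
  Hom′ = filterᵇ (homogeneousᵇ ns) (tPaths N′ t)

  homogeneous-inside : ∀ (p : Path N t) → homogeneous p ≡ true → ∀ side →
    (∀ w → (w <ᵇ n) ≡ (toℕ (Vec.head p) <ᵇ n) → side w ≡ true) → inside (side ∘ toℕ) p ≡ true
  homogeneous-inside p hom side side-of-head =
    trans (sym (all-map side toℕ (Vec.toList p)))
          (all-mono (verts p) (λ w same → side-of-head w (same-block⇒same-side n ns w _ same)) hom)

  inside-left⇒homogeneous : ∀ (p : Path N t) → inside left p ≡ true → homogeneous p ≡ true
  inside-left⇒homogeneous p@(x Vec.∷ _) inL =
    trans (all-cong (verts p) (λ w → cong (blockOf (n ∷ ns) w ≡ᵇ_) (blockOf-< n ns (toℕ x) (∧≡true⇒ˡ inL))))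
          (trans (all-map _ toℕ (Vec.toList p))
                 (all-mono (Vec.toList p) (λ v v<n → cong (_≡ᵇ 0) (blockOf-< n ns (toℕ v) v<n)) inL))

  homogeneous-↑ʳ : ∀ (p : Path N′ t) → homogeneous (Vec.map eR p) ≡ homogeneousᵇ ns p
  homogeneous-↑ʳ p@(x Vec.∷ _) = begin
    all (λ w → blockOf (n ∷ ns) w ≡ᵇ blockOf (n ∷ ns) (toℕ (eR x))) (map toℕ (Vec.toList (Vec.map eR p)))
      ≡⟨ cong (all _) (verts-enum (↑ʳ-enumeration n N′) p) ⟩
    all (λ w → blockOf (n ∷ ns) w ≡ᵇ blockOf (n ∷ ns) (toℕ (eR x))) (map (toℕ ∘ eR) (Vec.toList p))
      ≡⟨ all-map _ (toℕ ∘ eR) (Vec.toList p) ⟩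
    all (λ i → blockOf (n ∷ ns) (toℕ (eR i)) ≡ᵇ blockOf (n ∷ ns) (toℕ (eR x))) (Vec.toList p)
      ≡⟨ all-cong (Vec.toList p) (λ i → cong₂ _≡ᵇ_ (shift i) (shift x)) ⟩
    all (λ i → blockOf ns (toℕ i) ≡ᵇ blockOf ns (toℕ x)) (Vec.toList p)
      ≡⟨ all-map _ toℕ (Vec.toList p) ⟨
    homogeneousᵇ ns p  ∎
    where
    open ≡-Reasoning
    shift : ∀ i → blockOf (n ∷ ns) (toℕ (eR i)) ≡ suc (blockOf ns (toℕ i))
    shift i = trans (cong (blockOf (n ∷ ns)) (Fin.toℕ-↑ʳ n i)) (blockOf-+ n ns (toℕ i))

  homogeneous-split : ∀ (p : Path N t) → homogeneous p ∧ not (inside left p) ≡ inside right p ∧ homogeneous p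
  homogeneous-split p@(x Vec.∷ xs) =
    by-first-vertex (homogeneous p) (toℕ x <ᵇ n) (inside left xs) (inside right xs)
      (λ hom x<n → ∧≡true⇒ʳ (homogeneous-inside p hom (_<ᵇ n) (λ w same → trans same x<n)))
      (λ hom x≮n → ∧≡true⇒ʳ (homogeneous-inside p hom (not ∘ (_<ᵇ n)) (λ w same → cong not (trans same x≮n))))
    where
    by-first-vertex : ∀ h c L R → (h ≡ true → c ≡ true → L ≡ true) → (h ≡ true → c ≡ false → R ≡ true) →
      h ∧ not (c ∧ L) ≡ (not c ∧ R) ∧ h
    by-first-vertex false c     L R _ _ = sym (∧-zeroʳ _)
    by-first-vertex true  true  L R l _ rewrite l refl refl = refl
    by-first-vertex true  false L R _ r rewrite r refl refl = refl

  homogeneous-paths-left :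
    filterᵇ (inside left) (filterᵇ homogeneous (tPaths N t)) ≡ map (Vec.map eL) (tPaths n t)
  homogeneous-paths-left = begin
    filterᵇ (inside left) (filterᵇ homogeneous (tPaths N t))
      ≡⟨ filterᵇ-comm (inside left) homogeneous (tPaths N t) ⟩
    filterᵇ homogeneous (filterᵇ (inside left) (tPaths N t))
      ≡⟨ cong (filterᵇ homogeneous) (tPaths-inside (↑ˡ-enumeration n N′) t) ⟩
    filterᵇ homogeneous (map (Vec.map eL) (tPaths n t))
      ≡⟨ filterᵇ-map homogeneous (Vec.map eL) (tPaths n t) ⟩
    map (Vec.map eL) (filterᵇ (homogeneous ∘ Vec.map eL) (tPaths n t))
      ≡⟨ cong (map (Vec.map eL)) (trans (filterᵇ-cong (tPaths n t) homogeneous-eL)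
                                        (filterᵇ-true (tPaths n t))) ⟩
    map (Vec.map eL) (tPaths n t)  ∎
    where
    open ≡-Reasoning
    homogeneous-eL : ∀ p → homogeneous (Vec.map eL p) ≡ true
    homogeneous-eL p = inside-left⇒homogeneous (Vec.map eL p) (inside-enum (↑ˡ-enumeration n N′) p)

  homogeneous-paths-right :
    filterᵇ (not ∘ inside left) (filterᵇ homogeneous (tPaths N t)) ≡ map (Vec.map eR) Hom′
  homogeneous-paths-right = begin
    filterᵇ (not ∘ inside left) (filterᵇ homogeneous (tPaths N t))
      ≡⟨ filterᵇ-filterᵇ (not ∘ inside left) homogeneous (tPaths N t) ⟩
    filterᵇ (λ p → homogeneous p ∧ not (inside left p)) (tPaths N t)
      ≡⟨ filterᵇ-cong (tPaths N t) homogeneous-split ⟩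
    filterᵇ (λ p → inside right p ∧ homogeneous p) (tPaths N t)
      ≡⟨ filterᵇ-filterᵇ homogeneous (inside right) (tPaths N t) ⟨
    filterᵇ homogeneous (filterᵇ (inside right) (tPaths N t))
      ≡⟨ cong (filterᵇ homogeneous) (tPaths-inside (↑ʳ-enumeration n N′) t) ⟩
    filterᵇ homogeneous (map (Vec.map eR) (tPaths N′ t))
      ≡⟨ filterᵇ-map homogeneous (Vec.map eR) (tPaths N′ t) ⟩
    map (Vec.map eR) (filterᵇ (homogeneous ∘ Vec.map eR) (tPaths N′ t))
      ≡⟨ cong (map (Vec.map eR)) (filterᵇ-cong (tPaths N′ t) homogeneous-↑ʳ) ⟩
    map (Vec.map eR) (filterᵇ (homogeneousᵇ ns) (tPaths N′ t))  ∎
    where open ≡-Reasoning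

  disjointᵇ-left-right : ∀ A B →
    disjointᵇ (map (Vec.map eL) A ++ map (Vec.map eR) B) ≡ disjointᵇ A ∧ disjointᵇ B
  disjointᵇ-left-right A B = begin
    disjointᵇ (A′ ++ B′)
      ≡⟨ disjointᵇ-++ A′ B′ ⟩
    disjointᵇ A′ ∧ (disjointᵇ B′ ∧ all (inside (uncovered A′)) B′)
      ≡⟨ cong₂ (λ a b → a ∧ (b ∧ all (inside (uncovered A′)) B′))
               (disjointᵇ-enum (↑ˡ-enumeration n N′) A) (disjointᵇ-enum (↑ʳ-enumeration n N′) B) ⟩
    disjointᵇ A ∧ (disjointᵇ B ∧ all (inside (uncovered A′)) B′)
      ≡⟨ cong (λ b → disjointᵇ A ∧ (disjointᵇ B ∧ b))
              (trans (all-map _ (Vec.map eR) B) (all-true B avoids-A′)) ⟩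
    disjointᵇ A ∧ (disjointᵇ B ∧ true)
      ≡⟨ cong (disjointᵇ A ∧_) (∧-identityʳ (disjointᵇ B)) ⟩
    disjointᵇ A ∧ disjointᵇ B  ∎
    where
    open ≡-Reasoning
    A′ = map (Vec.map eL) A
    B′ = map (Vec.map eR) B
    left-vertices : all (_<ᵇ n) (concatMap verts A′) ≡ true
    left-vertices = trans (cong (all (_<ᵇ n)) (concatMap-verts-enum (↑ˡ-enumeration n N′) A))
      (trans (all-map (_<ᵇ n) (toℕ ∘ eL) (concatMap Vec.toList A))
             (all-true (concatMap Vec.toList A) (IncreasingEnumeration.selects (↑ˡ-enumeration n N′))))
    not-left : ∀ y xs → (y <ᵇ n) ≡ false → all (_<ᵇ n) xs ≡ true → any (y ≡ᵇ_) xs ≡ false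
    not-left y []       _   _     = refl
    not-left y (x ∷ xs) y≮n xs<n with y ≡ᵇ x in y≡x
    ... | true  rewrite ≡ᵇ⇒≡ y x y≡x = trans (sym (∧≡true⇒ˡ xs<n)) y≮n
    ... | false = not-left y xs y≮n (∧≡true⇒ʳ {x <ᵇ n} xs<n)
    avoids-A′ : ∀ (p : Path N′ t) → inside (uncovered A′) (Vec.map eR p) ≡ true
    avoids-A′ p = trans (cong (all (uncovered A′)) (Vec.toList-map eR p))
      (trans (all-map (uncovered A′) eR (Vec.toList p)) (all-true (Vec.toList p) (λ i →
        cong not (not-left (toℕ (eR i)) (concatMap verts A′)
                   (not≡true⇒ (IncreasingEnumeration.selects (↑ʳ-enumeration n N′) i)) left-vertices))))

  uncovered-left-right : ∀ (A : List (Path n t)) (B : List (Path N′ t)) →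
    disjointᵇ A ≡ true → disjointᵇ B ≡ true →
    N ∸ suc t ℕ.* (length A ℕ.+ length B) ≡ (n ∸ suc t ℕ.* length A) ℕ.+ (N′ ∸ suc t ℕ.* length B)
  uncovered-left-right A B disjA disjB =
    trans (cong (N ∸_) (ℕ.*-distribˡ-+ (suc t) (length A) (length B)))
          (+-∸-+ n N′ (disjoint-bound A disjA) (disjoint-bound B disjB))

  hermiteProductTerm-left-right : ∀ w A B →
    hermiteProductTerm t (n ∷ ns) w (map (Vec.map eL) A ++ map (Vec.map eR) B) ≡
    ⟦ disjointᵇ A ⟧ * (sign (length A) *
      hermiteProductTerm t ns (λ j → w ((n ∸ suc t ℕ.* length A) ℕ.+ j)) B)
  hermiteProductTerm-left-right w A B
    rewrite disjointᵇ-left-right A B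
          | all-++ homogeneous (map (Vec.map eL) A) (map (Vec.map eR) B)
          | all-map homogeneous (Vec.map eL) A
          | all-true A (λ p → inside-left⇒homogeneous (Vec.map eL p) (inside-enum (↑ˡ-enumeration n N′) p))
          | all-map homogeneous (Vec.map eR) B | all-cong B homogeneous-↑ʳ
          | List.length-++ (map (Vec.map eL) A) {map (Vec.map eR) B}
          | List.length-map (Vec.map eL) A | List.length-map (Vec.map eR) B
          | sign-+ (length A) (length B)
    with disjointᵇ A in disjA | disjointᵇ B in disjB
  ... | false | _     = refl
  ... | true  | false = ring (sign (length A))
    where
    ring : ∀ s → + 0 ≡ + 1 * (s * + 0)
    ring = solve-∀
  ... | true  | true  rewrite uncovered-left-right A B disjA disjB =
    ring ⟦ all (homogeneousᵇ ns) B ⟧ (sign (length A)) (sign (length B)) _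
    where
    ring : ∀ h a b x → h * (a * b * x) ≡ + 1 * (a * (h * (b * x)))
    ring = solve-∀

  sumSubsets-homogeneous : ∀ (f : List (Path N t) → ℤ) → InsertionInvariant f →
    (∀ S → all homogeneous S ≡ false → f S ≡ + 0) →
    sumSubsets (tPaths N t) f ≡
    sumSubsets (tPaths n t) (λ A → sumSubsets Hom′ (λ B → f (map (Vec.map eL) A ++ map (Vec.map eR) B)))
  sumSubsets-homogeneous f inv vanishes = begin
    sumSubsets (tPaths N t) f
      ≡⟨ sumSubsets-restrict homogeneous (tPaths N t) f vanishes ⟩
    sumSubsets Hom f
      ≡⟨ sumSubsets-partition (inside left) Hom f inv ⟩
    sumSubsets (filterᵇ (inside left) Hom) (λ As →
      sumSubsets (filterᵇ (not ∘ inside left) Hom) (λ Bs → f (As ++ Bs)))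
      ≡⟨ cong₂ (λ L R → sumSubsets L (λ As → sumSubsets R (λ Bs → f (As ++ Bs))))
               homogeneous-paths-left homogeneous-paths-right ⟩
    sumSubsets (map (Vec.map eL) (tPaths n t)) (λ As →
      sumSubsets (map (Vec.map eR) Hom′) (λ Bs → f (As ++ Bs)))
      ≡⟨ sumSubsets-cong (map (Vec.map eL) (tPaths n t)) (λ As → sumSubsets-map (Vec.map eR) Hom′ _) ⟩
    sumSubsets (map (Vec.map eL) (tPaths n t)) (λ As → sumSubsets Hom′ (λ B → f (As ++ map (Vec.map eR) B)))
      ≡⟨ sumSubsets-map (Vec.map eL) (tPaths n t) _ ⟩
    sumSubsets (tPaths n t) (λ A → sumSubsets Hom′ (λ B → f (map (Vec.map eL) A ++ map (Vec.map eR) B)))  ∎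
    where
    open ≡-Reasoning
    Hom = filterᵇ homogeneous (tPaths N t)

  eval-hermite-⊗ : ∀ (Q : Poly) →
    (∀ w → eval w Q ≡ sumSubsets (tPaths N′ t) (hermiteProductTerm t ns w)) →
    ∀ w → eval w (hermite t n ⊗ Q) ≡ sumSubsets (tPaths N t) (hermiteProductTerm t (n ∷ ns) w)
  eval-hermite-⊗ Q eval-Q w = begin
    eval w (hermite t n ⊗ Q)
      ≡⟨ eval-⊗ w (hermite t n) Q ⟩
    eval (λ i → eval (λ j → w (i ℕ.+ j)) Q) (hermite t n)
      ≡⟨ eval-hermite _ t n ⟩
    sumSubsets (tPaths n t) (λ A → ⟦ disjointᵇ A ⟧ * (sign (length A) * eval (shifted A) Q))
      ≡⟨ sumSubsets-cong (tPaths n t) (λ A → cong (λ z → ⟦ disjointᵇ A ⟧ * (sign (length A) * z))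
           (trans (eval-Q (shifted A))
                  (sumSubsets-restrict (homogeneousᵇ ns) (tPaths N′ t) _
                                       (hermiteProductTerm-inhomogeneous t ns {shifted A})))) ⟩
    sumSubsets (tPaths n t) (λ A → ⟦ disjointᵇ A ⟧ * (sign (length A) * sumSubsets Hom′ (term′ A)))
      ≡⟨ sumSubsets-cong (tPaths n t) (λ A →
           trans (cong (⟦ disjointᵇ A ⟧ *_) (sym (sumSubsets-* Hom′ (sign (length A)) (term′ A))))
           (trans (sym (sumSubsets-* Hom′ ⟦ disjointᵇ A ⟧ (λ B → sign (length A) * term′ A B)))
                  (sumSubsets-cong Hom′ (λ B → sym (hermiteProductTerm-left-right w A B))))) ⟩
    sumSubsets (tPaths n t) (λ A → sumSubsets Hom′ (λ B → term (map (Vec.map eL) A ++ map (Vec.map eR) B)))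
      ≡⟨ sumSubsets-homogeneous term (hermiteProductTerm-insertionInvariant t (n ∷ ns) w)
                                     (hermiteProductTerm-inhomogeneous t (n ∷ ns) {w}) ⟨
    sumSubsets (tPaths N t) term  ∎
    where
    open ≡-Reasoning
    term = hermiteProductTerm t (n ∷ ns) w
    shifted : List (Path n t) → ℕ → ℤ
    shifted A j = w ((n ∸ suc t ℕ.* length A) ℕ.+ j)
    term′ : List (Path n t) → List (Path N′ t) → ℤ
    term′ A = hermiteProductTerm t ns (shifted A)

eval-hermite-product : ∀ t ns w →
  eval w (polyProd (map (hermite t) ns)) ≡ sumSubsets (tPaths (sum ns) t) (hermiteProductTerm t ns w)
eval-hermite-product t []       w rewrite tPaths-0 t | ℕ.0∸n≡0 (suc t ℕ.* 0) =
  trans (ℤ.+-identityʳ _) (sym (ℤ.*-identityˡ _))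
eval-hermite-product t (n ∷ ns) w =
  HermiteProduct.eval-hermite-⊗ t n ns (polyProd (map (hermite t) ns)) (eval-hermite-product t ns) w

𝓛-hermite-product : ∀ t ns → 𝓛 t (polyProd (map (hermite t) ns)) ≡
  sumSubsets (tPaths (sum ns) t) (λ T → ⟦ all (homogeneousᵇ ns) T ⟧ * sign (length T) *
                                        (⟦ disjointᵇ T ⟧ * + μ t (sum ns ∸ suc t ℕ.* length T)))
𝓛-hermite-product t ns =
  trans (𝓛-from≡eval t 0 (polyProd (map (hermite t) ns)))
  (trans (eval-hermite-product t ns (+_ ∘ μ t))
         (sumSubsets-cong (tPaths (sum ns) t) regroup))
  where
  regroup : ∀ T → hermiteProductTerm t ns (+_ ∘ μ t) T ≡
    ⟦ all (homogeneousᵇ ns) T ⟧ * sign (length T) * (⟦ disjointᵇ T ⟧ * + μ t (sum ns ∸ suc t ℕ.* length T))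
  regroup T rewrite ⟦∧⟧ (disjointᵇ T) (all (homogeneousᵇ ns) T) =
    ring ⟦ disjointᵇ T ⟧ ⟦ all (homogeneousᵇ ns) T ⟧ (sign (length T)) (+ μ t (sum ns ∸ suc t ℕ.* length T))
    where
    ring : ∀ d h s m → d * h * (s * m) ≡ h * s * (d * m)
    ring = solve-∀

theorem5p1 : (t : ℕ) → 1 ≤ t → (ns : List ℕ) →
    𝓛 t (polyProd (map (hermite t) ns)) ≡ + inhomCoverings t ns
theorem5p1 t _ ns = begin
  𝓛 t (polyProd (map (hermite t) ns))
    ≡⟨ 𝓛-hermite-product t ns ⟩
  sumSubsets P (λ T → ⟦ all h T ⟧ * sign (length T) * (⟦ disjointᵇ T ⟧ * + μ t (sum ns ∸ suc t ℕ.* length T)))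
    ≡⟨ sumNested-coverings (λ T → ⟦ all h T ⟧ * sign (length T)) ⟨
  sumNested P (λ T S → ⟦ all h T ⟧ * sign (length T) * ⟦ isCoveringᵇ S ⟧)
    ≡⟨ inclusion-exclusion P h (⟦_⟧ ∘ isCoveringᵇ) ⟩
  sumSubsets P (λ S → ⟦ all (not ∘ h) S ⟧ * ⟦ isCoveringᵇ S ⟧)
    ≡⟨ sumSubsets-cong P (λ S → trans (sym (⟦∧⟧ (all (not ∘ h) S) (isCoveringᵇ S)))
         (cong ⟦_⟧ (trans (∧-comm (all (not ∘ h) S) (isCoveringᵇ S))
                          (∧-assoc (disjointᵇ S) (coversᵇ S) (all (not ∘ h) S))))) ⟩
  sumSubsets P (λ S → ⟦ disjointᵇ S ∧ coversᵇ S ∧ all (not ∘ h) S ⟧)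
    ≡⟨ length-filterᵇ-pathSets (sum ns) t _ ⟨
  + inhomCoverings t ns  ∎
  where
  open ≡-Reasoning
  P = tPaths (sum ns) t
  h = homogeneousᵇ ns
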